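{- Let $n\ge1$ and $P=[2]\times[n]$. The statistic $I\mapsto|\mathrm{Max}(I)|-|\mathrm{Min}(I)|$ (number of maximal elements of $I$ minus number of minimal elements of $I$) is $0$-mesic under rowmotion on $\mathcal{IC}(P)$.
   Context: $[k]$ is the chain $1<\cdots<k$; $[2]\times[n]$ is the Cartesian product poset with $(a,b)\le(c,d)$ iff $a\le c$ and $b\le d$. A subset $I$ is interval-closed if whenever $x,y\in I$ and $x\le z\le y$, then $z\in I$; $\mathcal{IC}(P)$ is the set of interval-closed subsets. $\mathrm{Max}(I)$ and $\mathrm{Min}(I)$ are the sets of maximal and minimal elements of $I$ (both empty for $I=\emptyset$). The toggle $t_x$ sends $I$ to $I\triangle\{x\}$ if this set is interval-closed, and to $I$ otherwise; rowmotion is $t_{x_1}\circ\cdots\circ t_{x_N}$ for a linear extension $(x_1,\dots,x_N)$ of $P$ (so $t_{x_N}$ is applied first; independent of the choice). A statistic is $c$-mesic if its average over every rowmotion orbit equals $c$. -}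

module Defs where

open import Data.Bool using (Bool; true; false; not; if_then_else_)
open import Data.Bool.Properties using () renaming (_≟_ to _≟ᵇ_)
open import Data.Fin using (Fin; _≤_; _≤?_)
open import Data.Fin.Properties using (all?) renaming (_≟_ to _≟ᶠ_)
open import Data.List using (List; []; _∷_; foldr; filter; length; allFin; cartesianProduct)
open import Data.Nat using (ℕ; zero; suc)
open import Data.Integer using (ℤ; +_; _-_) renaming (_+_ to _+ℤ_)
open import Data.Product using (_×_; _,_)
open import Relation.Binary.PropositionalEquality using (_≡_; _≢_)
open import Relation.Nullary using (Dec; yes; no; ¬_)
open import Relation.Nullary.Decidable using (_×-dec_; _→-dec_; ¬?)

-- Elements of the poset P = [2] × [n]  (chains indexed from 0 via Fin)
Elem : ℕ → Set
Elem n = Fin 2 × Fin n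

_≤P_ : ∀ {n} → Elem n → Elem n → Set
(a , b) ≤P (c , d) = (a ≤ c) × (b ≤ d)

_≤P?_ : ∀ {n} (x y : Elem n) → Dec (x ≤P y)
(a , b) ≤P? (c , d) = (a ≤? c) ×-dec (b ≤? d)

_<P_ : ∀ {n} → Elem n → Elem n → Set
x <P y = (x ≤P y) × (x ≢ y)

_≟E_ : ∀ {n} (x y : Elem n) → Dec (x ≡ y)
(a , b) ≟E (c , d) with a ≟ᶠ c | b ≟ᶠ d
... | yes Relation.Binary.PropositionalEquality.refl | yes Relation.Binary.PropositionalEquality.refl = yes Relation.Binary.PropositionalEquality.refl
... | no p | _ = no (λ { Relation.Binary.PropositionalEquality.refl → p Relation.Binary.PropositionalEquality.refl })
... | yes _ | no q = no (λ { Relation.Binary.PropositionalEquality.refl → q Relation.Binary.PropositionalEquality.refl })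

_<P?_ : ∀ {n} (x y : Elem n) → Dec (x <P y)
x <P? y = (x ≤P? y) ×-dec ¬? (x ≟E y)

allE? : ∀ {n} {P : Elem n → Set} → (∀ e → Dec (P e)) → Dec (∀ e → P e)
allE? {P = P} P? with all? (λ a → all? (λ b → P? (a , b)))
... | yes h = yes (λ { (a , b) → h a b })
... | no ¬h = no (λ h → ¬h (λ a b → h (a , b)))

Subset : ℕ → Set
Subset n = Elem n → Bool

_∈_ : ∀ {n} → Elem n → Subset n → Set
x ∈ I = I x ≡ true

_∈?_ : ∀ {n} (x : Elem n) (I : Subset n) → Dec (x ∈ I)
x ∈? I = I x ≟ᵇ true

IsIntervalClosed : ∀ {n} → Subset n → Set
IsIntervalClosed I = ∀ x y z → x ∈ I → y ∈ I → x ≤P z → z ≤P y → z ∈ I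

isIntervalClosed? : ∀ {n} (I : Subset n) → Dec (IsIntervalClosed I)
isIntervalClosed? I =
  allE? λ x → allE? λ y → allE? λ z →
    (x ∈? I) →-dec (y ∈? I) →-dec (x ≤P? z) →-dec (z ≤P? y) →-dec (z ∈? I)

flip : ∀ {n} → Elem n → Subset n → Subset n
flip x I y with y ≟E x
... | yes _ = not (I y)
... | no _ = I y

toggle : ∀ {n} → Elem n → Subset n → Subset n
toggle x I with isIntervalClosed? (flip x I)
... | yes _ = flip x I
... | no _ = I

-- a linear extension of [2] × [n]: row-major order
--   (0,0), (0,1), ..., (0,n-1), (1,0), ..., (1,n-1)
linExt : (n : ℕ) → List (Elem n)
linExt n = cartesianProduct (allFin 2) (allFin n)

-- rowmotion = t_{x_1} ∘ ⋯ ∘ t_{x_N}  (t_{x_N} applied first)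
rowmotion : ∀ {n} → Subset n → Subset n
rowmotion {n} I = foldr toggle I (linExt n)

iterate : ∀ {A : Set} → (A → A) → ℕ → A → A
iterate f zero a = a
iterate f (suc k) a = f (iterate f k a)

_≐_ : ∀ {n} → Subset n → Subset n → Set
I ≐ J = ∀ x → I x ≡ J x

IsMax : ∀ {n} → Subset n → Elem n → Set
IsMax I x = (x ∈ I) × (∀ y → y ∈ I → ¬ (x <P y))

IsMin : ∀ {n} → Subset n → Elem n → Set
IsMin I x = (x ∈ I) × (∀ y → y ∈ I → ¬ (y <P x))

isMax? : ∀ {n} (I : Subset n) (x : Elem n) → Dec (IsMax I x)
isMax? I x = (x ∈? I) ×-dec allE? (λ y → (y ∈? I) →-dec ¬? (x <P? y))

isMin? : ∀ {n} (I : Subset n) (x : Elem n) → Dec (IsMin I x)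
isMin? I x = (x ∈? I) ×-dec allE? (λ y → (y ∈? I) →-dec ¬? (y <P? x))

numMax : ∀ {n} → Subset n → ℕ
numMax {n} I = length (filter (isMax? I) (linExt n))

numMin : ∀ {n} → Subset n → ℕ
numMin {n} I = length (filter (isMin? I) (linExt n))

stat : ∀ {n} → Subset n → ℤ
stat I = (+ numMax I) - (+ numMin I)

sumℤ : ℕ → (ℕ → ℤ) → ℤ
sumℤ zero f = + 0
sumℤ (suc k) f = sumℤ k f +ℤ f k

module Submission where

-- An interval-closed subset of [2] × [n] is a "shape": one interval of columns in
-- each row, with the upper row 1 weakly to the left of the lower row 0 whenever
-- both are nonempty. Sweeping the toggles through row 1 and then row 0 computes
-- rowmotion on shapes by an explicit case analysis. On a shape, |Max| − |Min|
-- equals G − g, where G = 1 if row 0 overhangs row 1 on the right of a column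
-- filled in both rows (RightOverhang) and g = 1 if row 1 overhangs row 0 on the
-- left of one (LeftOverhang).
-- The case analysis shows g (rowmotion I) = G I, so the statistic at I is
-- g (rowmotion I) − g I and its sum over an orbit telescopes to 0.

open import Defs
open import Data.Nat using (ℕ; _≤_; _<_; zero; suc; _+_; z≤n; s≤s; _≤?_; _<?_; _≟_)
open import Data.Nat.Properties
open import Data.Integer using (ℤ; +_; _-_) renaming (_+_ to _+ℤ_)
open import Data.Integer.Properties using (+-inverseʳ; i≡j⇒i-j≡0)
open import Data.Integer.Tactic.RingSolver using (solve-∀)
open import Data.Bool using (Bool; true; false; not; _∧_; if_then_else_)
open import Data.Bool.Properties using () renaming (_≟_ to _≟ᵇ_)
open import Data.Empty using (⊥-elim)
open import Data.Fin using (Fin; toℕ; fromℕ<) renaming (zero to fzero; suc to fsuc; _≟_ to _≟ᶠ_)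
open import Data.Fin.Properties using (toℕ-injective; toℕ-fromℕ<; toℕ<n; any?)
open import Data.List using (List; []; _∷_; foldr; map; _++_; allFin; tabulate; filter; length)
open import Data.List.Properties using (filter-++; length-++; ++-identityʳ; filter-accept; filter-reject; foldr-++)
open import Function using (_∘_)
open import Data.Product using (_×_; _,_; proj₁; proj₂; Σ; ∃)
open import Data.Sum using (_⊎_; inj₁; inj₂)
open import Relation.Binary using (tri<; tri≈; tri>)
open import Relation.Binary.PropositionalEquality using (_≡_; _≢_; refl; sym; trans; cong; cong₂; subst; subst₂; module ≡-Reasoning)
open import Relation.Nullary using (¬_; Dec; yes; no; does)
open import Relation.Nullary.Decidable using (dec-true; dec-false; _×-dec_)

true≢false : true ≢ false
true≢false ()

-- (l , h) is the half-open range of columns l ≤ c < h; it is empty when h ≤ l.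
Interval : Set
Interval = ℕ × ℕ

opaque
  inInterval : Interval → ℕ → Bool
  inInterval (l , h) c = does (l ≤? c) ∧ does (c <? h)

  inInterval-true : ∀ {l h c} → l ≤ c → c < h → inInterval (l , h) c ≡ true
  inInterval-true {l} {h} {c} p q rewrite dec-true (l ≤? c) p | dec-true (c <? h) q = refl

  inInterval-below : ∀ {l h c} → c < l → inInterval (l , h) c ≡ false
  inInterval-below {l} {h} {c} p rewrite dec-false (l ≤? c) (<⇒≱ p) = refl

  inInterval-above : ∀ {l h c} → h ≤ c → inInterval (l , h) c ≡ false
  inInterval-above {l} {h} {c} p with does (l ≤? c)
  ... | false = refl
  ... | true rewrite dec-false (c <? h) (≤⇒≯ p) = refl

  inInterval-bounds : ∀ {l h c} → inInterval (l , h) c ≡ true → l ≤ c × c < h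
  inInterval-bounds {l} {h} {c} e with l ≤? c | c <? h
  ... | yes p | yes q = p , q
  ... | yes p | no q = ⊥-elim (true≢false (trans (sym e) (inInterval-above {l} {h} {c} (≮⇒≥ q))))
  ... | no p | _ = ⊥-elim (true≢false (trans (sym e) (inInterval-below {l} {h} {c} (≰⇒> p))))

inInterval-empty : ∀ {l h c} → h ≤ l → inInterval (l , h) c ≡ false
inInterval-empty {l} {h} {c} p with c <? l
... | yes q = inInterval-below {l} {h} {c} q
... | no q = inInterval-above {l} {h} {c} (≤-trans p (≮⇒≥ q))

inInterval-false : ∀ {l h c} → inInterval (l , h) c ≡ false → l ≤ c → h ≤ c
inInterval-false {l} {h} {c} e lc with c <? h
... | yes q = ⊥-elim (true≢false (trans (sym (inInterval-true lc q)) e))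
... | no q = ≮⇒≥ q

≡true-iff⇒≡ : ∀ (b b′ : Bool) → (b ≡ true → b′ ≡ true) → (b′ ≡ true → b ≡ true) → b′ ≡ b
≡true-iff⇒≡ false false _ _ = refl
≡true-iff⇒≡ true true _ _ = refl
≡true-iff⇒≡ false true f g = sym (g refl)
≡true-iff⇒≡ true false f g = f refl

inInterval-≡ : ∀ {l h l′ h′ c} → (l ≤ c × c < h → l′ ≤ c × c < h′) → (l′ ≤ c × c < h′ → l ≤ c × c < h) →
  inInterval (l′ , h′) c ≡ inInterval (l , h) c
inInterval-≡ {l} {h} {l′} {h′} {c} f g =
  ≡true-iff⇒≡ (inInterval (l , h) c) (inInterval (l′ , h′) c)
    (λ e → let (p , q) = f (inInterval-bounds {l} {h} e) in inInterval-true p q)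
    (λ e → let (p , q) = g (inInterval-bounds {l′} {h′} e) in inInterval-true p q)

pred-of : ∀ {i j} → i < j → Σ ℕ (λ m → j ≡ suc m)
pred-of {j = suc m} _ = m , refl

-- Shapes

Shape : Set
Shape = Interval × Interval

row : Fin 2 → Shape → Interval
row fzero σ = proj₁ σ
row (fsuc fzero) σ = proj₂ σ

setRow : Fin 2 → Interval → Shape → Shape
setRow fzero iv σ = iv , proj₂ σ
setRow (fsuc fzero) iv σ = proj₁ σ , iv

⟦_⟧ : ∀ {n} → Shape → Subset n
⟦ σ ⟧ (a , c) = inInterval (row a σ) (toℕ c)

-- Row 1 lies above row 0, so two nonempty rows form an interval-closed set
-- exactly when row 1 is row 0 shifted weakly to the left.
IsICShape : Shape → Set
IsICShape ((l0 , h0) , (l1 , h1)) = (h0 ≤ l0) ⊎ (h1 ≤ l1) ⊎ ((l1 ≤ l0) × (h1 ≤ h0))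

r0 r1 : Fin 2
r0 = fzero
r1 = fsuc fzero

row-setRow : ∀ a iv σ → row a (setRow a iv σ) ≡ iv
row-setRow fzero iv σ = refl
row-setRow (fsuc fzero) iv σ = refl

row-setRow-other : ∀ a b iv σ → b ≢ a → row b (setRow a iv σ) ≡ row b σ
row-setRow-other fzero fzero iv σ ne = ⊥-elim (ne refl)
row-setRow-other fzero (fsuc fzero) iv σ ne = refl
row-setRow-other (fsuc fzero) fzero iv σ ne = refl
row-setRow-other (fsuc fzero) (fsuc fzero) iv σ ne = ⊥-elim (ne refl)

setRow-setRow : ∀ a iv iv′ σ → setRow a iv′ (setRow a iv σ) ≡ setRow a iv′ σ
setRow-setRow fzero iv iv′ σ = refl
setRow-setRow (fsuc fzero) iv iv′ σ = refl

cell : ∀ {n} (a : Fin 2) {c : ℕ} → c < n → Elem n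
cell a p = a , fromℕ< p

⟦⟧-cell : ∀ {n} (σ : Shape) (a : Fin 2) {c : ℕ} (p : c < n) → ⟦ σ ⟧ (cell a p) ≡ inInterval (row a σ) c
⟦⟧-cell σ a p = cong (inInterval (row a σ)) (toℕ-fromℕ< p)

cell≤cell : ∀ {n} (a : Fin 2) {c d} (p : c < n) (q : d < n) → c ≤ d → cell a p ≤P cell a q
cell≤cell a p q le = ≤-refl , subst₂ _≤_ (sym (toℕ-fromℕ< p)) (sym (toℕ-fromℕ< q)) le

cell≤ : ∀ {n} (a : Fin 2) {c} (p : c < n) (u : Fin n) → c ≤ toℕ u → cell a p ≤P (a , u)
cell≤ a p u le = ≤-refl , subst (_≤ toℕ u) (sym (toℕ-fromℕ< p)) le

≤cell : ∀ {n} (a : Fin 2) {c} (p : c < n) (u : Fin n) → toℕ u ≤ c → (a , u) ≤P cell a p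
≤cell a p u le = ≤-refl , subst (toℕ u ≤_) (sym (toℕ-fromℕ< p)) le

r0≤r1 : ∀ {n} {c d} (p : c < n) (q : d < n) → c ≤ d → cell r0 p ≤P cell r1 q
r0≤r1 p q le = z≤n , proj₂ (cell≤cell r0 p q le)

hole⇒¬intervalClosed : ∀ {n} (I : Subset n) (x y z : Elem n) → x ∈ I → y ∈ I → x ≤P z → z ≤P y → I z ≡ false →
  ¬ IsIntervalClosed I
hole⇒¬intervalClosed I x y z x∈I y∈I x≤z z≤y z∉I ic = true≢false (trans (sym (ic x y z x∈I y∈I x≤z z≤y)) z∉I)

shape-intervalClosed : ∀ {n} (σ : Shape) → IsICShape σ → IsIntervalClosed {n} ⟦ σ ⟧
shape-intervalClosed ((l0 , h0) , (l1 , h1)) ok (fzero , b) (fzero , d) (fzero , c) x∈ y∈ (_ , b≤c) (_ , c≤d) =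
  inInterval-true (≤-trans (proj₁ (inInterval-bounds {l0} {h0} x∈)) b≤c) (≤-<-trans c≤d (proj₂ (inInterval-bounds {l0} {h0} y∈)))
shape-intervalClosed ((l0 , h0) , (l1 , h1)) ok (fsuc fzero , b) (fsuc fzero , d) (fsuc fzero , c) x∈ y∈ (_ , b≤c) (_ , c≤d) =
  inInterval-true (≤-trans (proj₁ (inInterval-bounds {l1} {h1} x∈)) b≤c) (≤-<-trans c≤d (proj₂ (inInterval-bounds {l1} {h1} y∈)))
shape-intervalClosed ((l0 , h0) , (l1 , h1)) ok (fzero , b) (fsuc fzero , d) (a , c) x∈ y∈ (_ , b≤c) (_ , c≤d)
  with inInterval-bounds {l0} {h0} x∈ | inInterval-bounds {l1} {h1} y∈ | ok
... | p , p′ | q′ , q | inj₁ e = ⊥-elim (<⇒≱ (≤-<-trans p p′) e)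
... | p , p′ | q′ , q | inj₂ (inj₁ e) = ⊥-elim (<⇒≱ (≤-<-trans q′ q) e)
shape-intervalClosed ((l0 , h0) , (l1 , h1)) ok (fzero , b) (fsuc fzero , d) (fzero , c) x∈ y∈ (_ , b≤c) (_ , c≤d)
  | p , p′ | q′ , q | inj₂ (inj₂ (_ , h10)) = inInterval-true (≤-trans p b≤c) (<-≤-trans (≤-<-trans c≤d q) h10)
shape-intervalClosed ((l0 , h0) , (l1 , h1)) ok (fzero , b) (fsuc fzero , d) (fsuc fzero , c) x∈ y∈ (_ , b≤c) (_ , c≤d)
  | p , p′ | q′ , q | inj₂ (inj₂ (l10 , _)) = inInterval-true (≤-trans l10 (≤-trans p b≤c)) (≤-<-trans c≤d q)
shape-intervalClosed σ ok (fsuc fzero , b) y (fzero , c) x∈ y∈ (() , _) _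
shape-intervalClosed σ ok (x , b) (fzero , d) (fsuc fzero , c) x∈ y∈ _ (() , _)

shape-¬intervalClosed : ∀ {n} l0 h0 l1 h1 → h0 ≤ n → h1 ≤ n → l0 < h0 → l1 < h1 → l0 < h1 →
  (l0 < l1 ⊎ h0 < h1) → ¬ IsIntervalClosed {n} ⟦ (l0 , h0) , (l1 , h1) ⟧
shape-¬intervalClosed {n} l0 h0 l1 (suc k) h0≤n h1≤n l0<h0 l1<h1 l0<h1 (inj₁ l0<l1) =
  hole⇒¬intervalClosed ⟦ σ ⟧ (cell r0 p) (cell r1 q) (cell r1 p)
    (trans (⟦⟧-cell σ r0 p) (inInterval-true ≤-refl l0<h0))
    (trans (⟦⟧-cell σ r1 q) (inInterval-true (≤-pred l1<h1) ≤-refl))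
    (r0≤r1 p p ≤-refl) (cell≤cell r1 p q (≤-pred l0<h1))
    (trans (⟦⟧-cell σ r1 p) (inInterval-below {l1} {suc k} {l0} l0<l1))
  where
  σ = (l0 , h0) , (l1 , suc k)
  p : l0 < n
  p = <-≤-trans l0<h0 h0≤n
  q : k < n
  q = h1≤n
shape-¬intervalClosed {n} l0 h0 l1 (suc k) h0≤n h1≤n l0<h0 l1<h1 l0<h1 (inj₂ h0<h1) =
  hole⇒¬intervalClosed ⟦ σ ⟧ (cell r0 p) (cell r1 q) (cell r0 q)
    (trans (⟦⟧-cell σ r0 p) (inInterval-true ≤-refl l0<h0))
    (trans (⟦⟧-cell σ r1 q) (inInterval-true (≤-pred l1<h1) ≤-refl))
    (cell≤cell r0 p q (≤-pred l0<h1)) (r0≤r1 q q ≤-refl)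
    (trans (⟦⟧-cell σ r0 q) (inInterval-above {l0} {h0} {k} (≤-pred h0<h1)))
  where
  σ = (l0 , h0) , (l1 , suc k)
  p : l0 < n
  p = <-≤-trans l0<h0 h0≤n
  q : k < n
  q = h1≤n

-- Toggles

≐-refl : ∀ {n} {I : Subset n} → I ≐ I
≐-refl x = refl

≐-sym : ∀ {n} {I J : Subset n} → I ≐ J → J ≐ I
≐-sym e x = sym (e x)

≐-trans : ∀ {n} {I J K : Subset n} → I ≐ J → J ≐ K → I ≐ K
≐-trans e f x = trans (e x) (f x)

≡⇒≐ : ∀ {n} {I J : Subset n} → I ≡ J → I ≐ J
≡⇒≐ refl = ≐-refl

intervalClosed-resp-≐ : ∀ {n} {I J : Subset n} → I ≐ J → IsIntervalClosed I → IsIntervalClosed J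
intervalClosed-resp-≐ e ic x y z x∈J y∈J x≤z z≤y =
  trans (sym (e z)) (ic x y z (trans (e x) x∈J) (trans (e y) y∈J) x≤z z≤y)

flip-here : ∀ {n} (x : Elem n) (I : Subset n) → flip x I x ≡ not (I x)
flip-here x I with x ≟E x
... | yes _ = refl
... | no x≢x = ⊥-elim (x≢x refl)

flip-elsewhere : ∀ {n} (x : Elem n) (I : Subset n) (y : Elem n) → y ≢ x → flip x I y ≡ I y
flip-elsewhere x I y y≢x with y ≟E x
... | yes y≡x = ⊥-elim (y≢x y≡x)
... | no _ = refl

flip-cong : ∀ {n} (x : Elem n) {I J : Subset n} → I ≐ J → flip x I ≐ flip x J
flip-cong x {I} {J} e y = at (y ≟E x)
  where
  at : Dec (y ≡ x) → flip x I y ≡ flip x J y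
  at (yes refl) = trans (flip-here x I) (trans (cong not (e x)) (sym (flip-here x J)))
  at (no y≢x) = trans (flip-elsewhere x I y y≢x) (trans (e y) (sym (flip-elsewhere x J y y≢x)))

toggle-accept : ∀ {n} (x : Elem n) (I : Subset n) → IsIntervalClosed (flip x I) → toggle x I ≡ flip x I
toggle-accept x I ic with isIntervalClosed? (flip x I)
... | yes _ = refl
... | no ¬ic = ⊥-elim (¬ic ic)

toggle-reject : ∀ {n} (x : Elem n) (I : Subset n) → ¬ IsIntervalClosed (flip x I) → toggle x I ≡ I
toggle-reject x I ¬ic with isIntervalClosed? (flip x I)
... | yes ic = ⊥-elim (¬ic ic)
... | no _ = refl

toggle-cong : ∀ {n} (x : Elem n) {I J : Subset n} → I ≐ J → toggle x I ≐ toggle x J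
toggle-cong x {I} {J} e = by (isIntervalClosed? (flip x I))
  where
  flip≐ = flip-cong x e
  by : Dec (IsIntervalClosed (flip x I)) → toggle x I ≐ toggle x J
  by (yes ic) = ≐-trans (≡⇒≐ (toggle-accept x I ic))
    (≐-trans flip≐ (≡⇒≐ (sym (toggle-accept x J (intervalClosed-resp-≐ flip≐ ic)))))
  by (no ¬ic) = ≐-trans (≡⇒≐ (toggle-reject x I ¬ic))
    (≐-trans e (≡⇒≐ (sym (toggle-reject x J (λ ic → ¬ic (intervalClosed-resp-≐ (≐-sym flip≐) ic))))))

toggle-intervalClosed : ∀ {n} (x : Elem n) (I : Subset n) → IsIntervalClosed I → IsIntervalClosed (toggle x I)
toggle-intervalClosed x I ic = by (isIntervalClosed? (flip x I))
  where
  by : Dec (IsIntervalClosed (flip x I)) → IsIntervalClosed (toggle x I)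
  by (yes ic′) = subst IsIntervalClosed (sym (toggle-accept x I ic′)) ic′
  by (no ¬ic′) = subst IsIntervalClosed (sym (toggle-reject x I ¬ic′)) ic

DiffersAt : Interval → Interval → ℕ → Set
DiffersAt iv iv′ u = (inInterval iv′ u ≡ not (inInterval iv u)) × (∀ c → c ≢ u → inInterval iv′ c ≡ inInterval iv c)

grow-top : ∀ {l h} → l ≤ h → DiffersAt (l , h) (l , suc h) h
grow-top {l} {h} p = trans (inInterval-true p ≤-refl) (cong not (sym (inInterval-above {l} {h} {h} ≤-refl))) ,
  λ c ne → inInterval-≡ (λ (a , b) → a , m<n⇒m<1+n b) (λ (a , b) → a , ≤∧≢⇒< (≤-pred b) ne)

grow-bottom : ∀ {u h} → suc u ≤ h → DiffersAt (suc u , h) (u , h) u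
grow-bottom {u} {h} p = trans (inInterval-true ≤-refl p) (cong not (sym (inInterval-below {suc u} {h} {u} ≤-refl))) ,
  λ c ne → inInterval-≡ (λ (a , b) → ≤-trans (n≤1+n u) a , b) (λ (a , b) → ≤∧≢⇒< a (λ e → ne (sym e)) , b)

shrink-bottom : ∀ {l h} → l < h → DiffersAt (l , h) (suc l , h) l
shrink-bottom {l} {h} p = trans (inInterval-below {suc l} {h} {l} ≤-refl) (cong not (sym (inInterval-true ≤-refl p))) ,
  λ c ne → inInterval-≡ (λ (a , b) → ≤∧≢⇒< a (λ e → ne (sym e)) , b) (λ (a , b) → ≤-trans (n≤1+n l) a , b)

shrink-top : ∀ {l u} → l ≤ u → DiffersAt (l , suc u) (l , u) u
shrink-top {l} {u} p = trans (inInterval-above {l} {u} {u} ≤-refl) (cong not (sym (inInterval-true p ≤-refl))) ,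
  λ c ne → inInterval-≡ (λ (a , b) → a , ≤∧≢⇒< (≤-pred b) ne) (λ (a , b) → a , m<n⇒m<1+n b)

fill-empty : ∀ {l h u} → h ≤ l → DiffersAt (l , h) (u , suc u) u
fill-empty {l} {h} {u} p = trans (inInterval-true ≤-refl ≤-refl) (cong not (sym (inInterval-empty {l} {h} {u} p))) ,
  λ c ne → inInterval-≡ (λ (a , b) → ⊥-elim (<⇒≱ (≤-<-trans a b) p))
                        (λ (a , b) → ⊥-elim (ne (≤-antisym (≤-pred b) a)))

flip-shape : ∀ {n} σ a (u : Fin n) iv → DiffersAt (row a σ) iv (toℕ u) → flip (a , u) ⟦ σ ⟧ ≐ ⟦ setRow a iv σ ⟧
flip-shape {n} σ a u iv (here , elsewhere) (b , c) = at ((b , c) ≟E (a , u))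
  where
  at : Dec ((b , c) ≡ (a , u)) → flip (a , u) ⟦ σ ⟧ (b , c) ≡ ⟦ setRow a iv σ ⟧ (b , c)
  at (yes refl) = trans (flip-here (a , u) ⟦ σ ⟧)
    (sym (trans (cong (λ r → inInterval r (toℕ u)) (row-setRow a iv σ)) here))
  at (no bc≢au) = trans (flip-elsewhere (a , u) ⟦ σ ⟧ (b , c) bc≢au) (sameRow? (b ≟ᶠ a))
    where
    sameRow? : Dec (b ≡ a) → inInterval (row b σ) (toℕ c) ≡ inInterval (row b (setRow a iv σ)) (toℕ c)
    sameRow? (yes refl) = sym (trans (cong (λ r → inInterval r (toℕ c)) (row-setRow a iv σ))
                               (elsewhere (toℕ c) (λ e → bc≢au (cong (a ,_) (toℕ-injective e)))))
    sameRow? (no b≢a) = sym (cong (λ r → inInterval r (toℕ c)) (row-setRow-other a b iv σ b≢a))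

toggle-shape-accept : ∀ {n} σ a (u : Fin n) iv → DiffersAt (row a σ) iv (toℕ u) → IsICShape (setRow a iv σ) →
  toggle (a , u) ⟦ σ ⟧ ≐ ⟦ setRow a iv σ ⟧
toggle-shape-accept σ a u iv d ok =
  ≐-trans (≡⇒≐ (toggle-accept _ _ (intervalClosed-resp-≐ (≐-sym flip≐) (shape-intervalClosed (setRow a iv σ) ok)))) flip≐
  where flip≐ = flip-shape σ a u iv d

toggle-shape-reject : ∀ {n} σ a (u : Fin n) iv → DiffersAt (row a σ) iv (toℕ u) →
  ¬ IsIntervalClosed {n} ⟦ setRow a iv σ ⟧ → toggle (a , u) ⟦ σ ⟧ ≐ ⟦ σ ⟧
toggle-shape-reject σ a u iv d ¬ic =
  ≡⇒≐ (toggle-reject _ _ (λ ic → ¬ic (intervalClosed-resp-≐ (flip-shape σ a u iv d) ic)))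

flip-cell : ∀ {n} σ a (u : Fin n) {c} (p : c < n) → c ≢ toℕ u → flip (a , u) ⟦ σ ⟧ (cell a p) ≡ inInterval (row a σ) c
flip-cell σ a u p c≢u = trans (flip-elsewhere (a , u) ⟦ σ ⟧ (cell a p) cell≢)
                              (⟦⟧-cell σ a p)
  where
  cell≢ : cell a p ≢ (a , u)
  cell≢ e = c≢u (trans (sym (toℕ-fromℕ< p)) (cong (λ x → toℕ (proj₂ x)) e))

flip-at : ∀ {n} σ a (u : Fin n) → flip (a , u) ⟦ σ ⟧ (a , u) ≡ not (inInterval (row a σ) (toℕ u))
flip-at σ a u = flip-here (a , u) ⟦ σ ⟧

toggle-rejects-above : ∀ {n} σ a (u : Fin n) {l k} → row a σ ≡ (l , suc k) → l ≤ k → suc k < toℕ u →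
  toggle (a , u) ⟦ σ ⟧ ≐ ⟦ σ ⟧
toggle-rejects-above {n} σ a u {l} {k} r l≤k k<u = ≡⇒≐ (toggle-reject _ _
  (hole⇒¬intervalClosed (flip (a , u) ⟦ σ ⟧) (cell a p) (a , u) (cell a q)
    (trans (flip-cell σ a u p (λ e → <-irrefl e (<-trans (n<1+n k) k<u)))
           (trans (cong (λ r → inInterval r k) r) (inInterval-true l≤k ≤-refl)))
    (trans (flip-at σ a u) (cong not (trans (cong (λ r → inInterval r (toℕ u)) r) (inInterval-above {l} {suc k} (<⇒≤ k<u)))))
    (cell≤cell a p q (n≤1+n k)) (cell≤ a q u (<⇒≤ k<u))
    (trans (flip-cell σ a u q (λ e → <-irrefl e k<u))
           (trans (cong (λ r → inInterval r (suc k)) r) (inInterval-above {l} {suc k} ≤-refl)))))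
  where
  q : suc k < n
  q = <-trans k<u (toℕ<n u)
  p : k < n
  p = <-trans (n<1+n k) q

toggle-rejects-below : ∀ {n} σ a (u : Fin n) {l h} → row a σ ≡ (l , h) → l < h → h ≤ n → suc (toℕ u) < l →
  toggle (a , u) ⟦ σ ⟧ ≐ ⟦ σ ⟧
toggle-rejects-below {n} σ a u {l} {h} r l<h h≤n u<l = ≡⇒≐ (toggle-reject _ _
  (hole⇒¬intervalClosed (flip (a , u) ⟦ σ ⟧) (a , u) (cell a p) (cell a q)
    (trans (flip-at σ a u) (cong not (trans (cong (λ r → inInterval r (toℕ u)) r) (inInterval-below {l} {h} (<-trans (n<1+n _) u<l)))))
    (trans (flip-cell σ a u p (λ e → <-irrefl (sym e) (<-trans (n<1+n _) u<l)))
           (trans (cong (λ r → inInterval r l) r) (inInterval-true ≤-refl l<h)))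
    (≤cell a q u (n≤1+n _)) (cell≤cell a q p (<⇒≤ u<l))
    (trans (flip-cell σ a u q (λ e → <-irrefl (sym e) (n<1+n _)))
           (trans (cong (λ r → inInterval r (suc (toℕ u))) r) (inInterval-below {l} {h} u<l)))))
  where
  p : l < n
  p = <-≤-trans l<h h≤n
  q : suc (toℕ u) < n
  q = <-trans u<l p

toggle-rejects-inside : ∀ {n} σ a (u : Fin n) {l h} → row a σ ≡ (l , h) → l < toℕ u → suc (toℕ u) < h → h ≤ n →
  toggle (a , u) ⟦ σ ⟧ ≐ ⟦ σ ⟧
toggle-rejects-inside {n} σ a u {l} {h} r l<u u<h h≤n = at (toℕ u) refl l<u
  where
  at : ∀ v → toℕ u ≡ v → l < v → toggle (a , u) ⟦ σ ⟧ ≐ ⟦ σ ⟧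
  at (suc m) u≡1+m (s≤s l≤m) = ≡⇒≐ (toggle-reject _ _
    (hole⇒¬intervalClosed (flip (a , u) ⟦ σ ⟧) (cell a p) (cell a q) (a , u)
      (trans (flip-cell σ a u p (λ e → <-irrefl (trans e u≡1+m) ≤-refl))
             (trans (cong (λ r → inInterval r m) r) (inInterval-true l≤m (<-trans m<u (<-trans (n<1+n _) u<h)))))
      (trans (flip-cell σ a u q (λ e → <-irrefl (sym e) ≤-refl))
             (trans (cong (λ r → inInterval r (suc (toℕ u))) r) (inInterval-true (≤-trans l≤u (n≤1+n _)) u<h)))
      (cell≤ a p u (<⇒≤ m<u)) (≤cell a q u (n≤1+n _))
      (trans (flip-at σ a u) (cong not (trans (cong (λ r → inInterval r (toℕ u)) r) (inInterval-true l≤u (<-trans (n<1+n _) u<h)))))))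
    where
    m<u : m < toℕ u
    m<u = subst (m <_) (sym u≡1+m) (n<1+n m)
    l≤u : l ≤ toℕ u
    l≤u = ≤-trans l≤m (<⇒≤ m<u)
    q : suc (toℕ u) < n
    q = <-≤-trans u<h h≤n
    p : m < n
    p = <-trans m<u (<-trans (n<1+n _) q)

-- Sweeping a row

-- Conversion checking must never unfold `toggle`: that would evaluate the
-- decision procedure isIntervalClosed? on symbolic shapes.
opaque
  toggle′ : ∀ {n} → Elem n → Subset n → Subset n
  toggle′ = toggle

  toggle′≡toggle : ∀ {n} (x : Elem n) (I : Subset n) → toggle′ x I ≡ toggle x I
  toggle′≡toggle x I = refl

  toggle′-cong : ∀ {n} (x : Elem n) {I J : Subset n} → I ≐ J → toggle′ x I ≐ toggle′ x J
  toggle′-cong = toggle-cong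

sweep : ∀ {n} → Fin 2 → List (Fin n) → Subset n → Subset n
sweep a xs S = foldr (λ c → toggle′ (a , c)) S xs

foldr-toggle-row : ∀ {n} (a : Fin 2) (xs : List (Fin n)) (S : Subset n) → foldr toggle S (map (a ,_) xs) ≡ sweep a xs S
foldr-toggle-row a [] S = refl
foldr-toggle-row a (x ∷ xs) S =
  trans (cong (toggle (a , x)) (foldr-toggle-row a xs S)) (sym (toggle′≡toggle (a , x) (sweep a xs S)))

rowmotion≡sweeps : ∀ {n} (I : Subset n) → rowmotion I ≡ sweep r0 (allFin n) (sweep r1 (allFin n) I)
rowmotion≡sweeps {n} I = begin
  foldr toggle I (row₀ ++ row₁ ++ [])                 ≡⟨ foldr-++ toggle I row₀ (row₁ ++ []) ⟩
  foldr toggle (foldr toggle I (row₁ ++ [])) row₀     ≡⟨ cong (λ J → foldr toggle J row₀) (foldr-++ toggle I row₁ []) ⟩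
  foldr toggle (foldr toggle I row₁) row₀             ≡⟨ cong (λ J → foldr toggle J row₀) (foldr-toggle-row r1 (allFin n) I) ⟩
  foldr toggle (sweep r1 (allFin n) I) row₀           ≡⟨ foldr-toggle-row r0 (allFin n) _ ⟩
  sweep r0 (allFin n) (sweep r1 (allFin n) I)         ∎
  where
  open ≡-Reasoning
  row₀ row₁ : List (Elem n)
  row₀ = map (r0 ,_) (allFin n)
  row₁ = map (r1 ,_) (allFin n)

sweep-cong : ∀ {n} (a : Fin 2) (xs : List (Fin n)) {I J : Subset n} → I ≐ J → sweep a xs I ≐ sweep a xs J
sweep-cong a [] e = e
sweep-cong a (x ∷ xs) e = toggle′-cong (a , x) (sweep-cong a xs e)

sweep-intervalClosed : ∀ {n} (a : Fin 2) (xs : List (Fin n)) (I : Subset n) → IsIntervalClosed I →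
  IsIntervalClosed (sweep a xs I)
sweep-intervalClosed a [] I ic = ic
sweep-intervalClosed a (x ∷ xs) I ic =
  subst IsIntervalClosed (sym (toggle′≡toggle (a , x) (sweep a xs I)))
    (toggle-intervalClosed (a , x) (sweep a xs I) (sweep-intervalClosed a xs I ic))

EnumeratesFrom : ∀ {k n} → ℕ → (Fin k → Fin n) → Set
EnumeratesFrom u f = ∀ i → toℕ (f i) ≡ u + toℕ i

enumeratesFrom-head : ∀ {k n u} {f : Fin (suc k) → Fin n} → EnumeratesFrom u f → toℕ (f fzero) ≡ u
enumeratesFrom-head {u = u} f≡ = trans (f≡ fzero) (+-identityʳ u)

enumeratesFrom-tail : ∀ {k n u} {f : Fin (suc k) → Fin n} → EnumeratesFrom u f → EnumeratesFrom (suc u) (f ∘ fsuc)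
enumeratesFrom-tail {u = u} f≡ i = trans (f≡ (fsuc i)) (+-suc u (toℕ i))

-- St u is the shape reached after toggling the columns u, …, n-1 of row a.
sweep-through : ∀ {n} (a : Fin 2) (St : ℕ → Shape) (S : Subset n) → S ≐ ⟦ St n ⟧ →
  (∀ (x : Fin n) → toggle′ (a , x) ⟦ St (suc (toℕ x)) ⟧ ≐ ⟦ St (toℕ x) ⟧) →
  sweep a (allFin n) S ≐ ⟦ St 0 ⟧
sweep-through {n} a St S init step = go n 0 (λ i → i) (λ i → refl) refl
  where
  go : ∀ m u (f : Fin m → Fin n) → EnumeratesFrom u f → u + m ≡ n → sweep a (tabulate f) S ≐ ⟦ St u ⟧
  go zero u f f≡ u+0≡n = subst (λ v → S ≐ ⟦ St v ⟧) (trans (sym u+0≡n) (+-identityʳ u)) init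
  go (suc m) u f f≡ u+m≡n = subst (λ v → toggle′ (a , f fzero) (sweep a (tabulate (f ∘ fsuc)) S) ≐ ⟦ St v ⟧) f0≡u
    (≐-trans (toggle′-cong (a , f fzero) (subst (λ v → sweep a (tabulate (f ∘ fsuc)) S ≐ ⟦ St (suc v) ⟧) (sym f0≡u) ih))
             (step (f fzero)))
    where
    f0≡u = enumeratesFrom-head f≡
    ih = go m (suc u) (f ∘ fsuc) (enumeratesFrom-tail f≡) (trans (sym (+-suc u m)) u+m≡n)

module ThreePhase (t₁ t₂ : ℕ) (A B C : ℕ → Shape) where

  St : ℕ → Shape
  St u = if does (t₁ <? u) then A u else (if does (t₂ <? u) then B u else C u)

  phase-A : ∀ {u} → t₁ < u → St u ≡ A u
  phase-A {u} p rewrite dec-true (t₁ <? u) p = refl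

  phase-B : ∀ {u} → t₂ < u → u ≤ t₁ → St u ≡ B u
  phase-B {u} p q rewrite dec-false (t₁ <? u) (≤⇒≯ q) | dec-true (t₂ <? u) p = refl

  phase-C : ∀ {u} → u ≤ t₂ → u ≤ t₁ → St u ≡ C u
  phase-C {u} p q rewrite dec-false (t₁ <? u) (≤⇒≯ q) | dec-false (t₂ <? u) (≤⇒≯ p) = refl

  sweep-phases : ∀ {n} (a : Fin 2) (S : Subset n) → S ≐ ⟦ St n ⟧ →
    (∀ (x : Fin n) → toggle′ (a , x) ⟦ St (suc (toℕ x)) ⟧ ≐ ⟦ St (toℕ x) ⟧) →
    sweep a (allFin n) S ≐ ⟦ C 0 ⟧
  sweep-phases a S init step =
    ≐-trans (sweep-through a St S init step) (≡⇒≐ (cong ⟦_⟧ (phase-C z≤n z≤n)))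

toggle′-via : ∀ {n} (x : Elem n) {σ τ : Shape} (σ′ τ′ : Shape) → σ ≡ σ′ → τ ≡ τ′ → toggle x ⟦ σ′ ⟧ ≐ ⟦ τ′ ⟧ →
  toggle′ x ⟦ σ ⟧ ≐ ⟦ τ ⟧
toggle′-via x {σ} _ _ refl refl e = ≐-trans (≡⇒≐ (toggle′≡toggle x ⟦ σ ⟧)) e

sweep-shift : ∀ {n} (a : Fin 2) (σ : Shape) {l k} → row a σ ≡ (l , suc k) → l ≤ k → suc k < n →
  IsICShape (setRow a (l , suc (suc k)) σ) → IsICShape (setRow a (suc l , suc (suc k)) σ) →
  sweep a (allFin n) ⟦ σ ⟧ ≐ ⟦ setRow a (suc l , suc (suc k)) σ ⟧
sweep-shift {n} a σ {l} {k} r l≤k h<n grown-ok shifted-ok =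
  sweep-phases a ⟦ σ ⟧ (≡⇒≐ (cong ⟦_⟧ (sym (phase-A h<n)))) step
  where
  h = suc k
  grown shifted : Shape
  grown = setRow a (l , suc h) σ
  shifted = setRow a (suc l , suc h) σ
  A B C : ℕ → Shape
  A _ = σ
  B _ = grown
  C _ = shifted
  open ThreePhase h l A B C
  step : ∀ (x : Fin n) → toggle′ (a , x) ⟦ St (suc (toℕ x)) ⟧ ≐ ⟦ St (toℕ x) ⟧
  step x with <-cmp (toℕ x) h
  ... | tri> _ _ p = toggle′-via (a , x) σ σ (phase-A (<-trans p (n<1+n _))) (phase-A p)
                       (toggle-rejects-above σ a x r l≤k p)
  ... | tri≈ _ p _ = toggle′-via (a , x) σ grown
                       (phase-A (subst (h <_) (sym (cong suc p)) (n<1+n h))) (phase-B (subst (l <_) (sym p) (s≤s l≤k)) (≤-reflexive p))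
                       (toggle-shape-accept σ a x (l , suc h)
                         (subst (DiffersAt (row a σ) (l , suc h)) (sym p)
                           (subst (λ iv → DiffersAt iv (l , suc h) h) (sym r) (grow-top (≤-trans l≤k (n≤1+n k))))) grown-ok)
  ... | tri< p _ _ with <-cmp l (toℕ x)
  ...   | tri< q _ _ = toggle′-via (a , x) grown grown (phase-B (<-trans q (n<1+n _)) p) (phase-B q (<⇒≤ p))
                         (toggle-rejects-inside grown a x (row-setRow a _ σ) q (s≤s p) h<n)
  ...   | tri≈ _ q _ = toggle′-via (a , x) grown shifted
                         (phase-B (subst (_< suc (toℕ x)) (sym q) (n<1+n _)) p) (phase-C (≤-reflexive (sym q)) (<⇒≤ p))
                         (subst (λ τ → toggle (a , x) ⟦ grown ⟧ ≐ ⟦ τ ⟧) (setRow-setRow a _ _ σ)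
                           (toggle-shape-accept grown a x (suc l , suc h)
                             (subst (λ iv → DiffersAt iv (suc l , suc h) (toℕ x)) (sym (row-setRow a _ σ))
                               (subst (DiffersAt (l , suc h) (suc l , suc h)) q (shrink-bottom (≤-trans (s≤s l≤k) (n≤1+n _)))))
                             (subst IsICShape (sym (setRow-setRow a _ _ σ)) shifted-ok)))
  ...   | tri> _ _ q = toggle′-via (a , x) shifted shifted (phase-C q p) (phase-C (<⇒≤ q) (<⇒≤ p))
                         (toggle-rejects-below shifted a x (row-setRow a _ σ) (s≤s (s≤s l≤k)) h<n (s≤s q))

⟦⟧-replace-empty : ∀ {n} a σ {l h l′ h′} → row a σ ≡ (l , h) → h ≤ l → h′ ≤ l′ →
  _≐_ {n} ⟦ σ ⟧ ⟦ setRow a (l′ , h′) σ ⟧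
⟦⟧-replace-empty {n} a σ {l} {h} {l′} {h′} r h≤l h′≤l′ (b , c) = sameRow? (b ≟ᶠ a)
  where
  sameRow? : Dec (b ≡ a) → inInterval (row b σ) (toℕ c) ≡ inInterval (row b (setRow a (l′ , h′) σ)) (toℕ c)
  sameRow? (yes refl) = trans (cong (λ r → inInterval r (toℕ c)) r)
    (trans (inInterval-empty {l} {h} {toℕ c} h≤l)
      (sym (trans (cong (λ r → inInterval r (toℕ c)) (row-setRow a (l′ , h′) σ)) (inInterval-empty {l′} {h′} {toℕ c} h′≤l′))))
  sameRow? (no b≢a) = sym (cong (λ r → inInterval r (toℕ c)) (row-setRow-other a b _ σ b≢a))

sweep₁-empty : ∀ {n} l0 h0 l1 h1 → l0 < h0 → h0 ≤ n → h1 ≤ l1 →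
  sweep r1 (allFin n) ⟦ (l0 , h0) , (l1 , h1) ⟧ ≐ ⟦ (l0 , h0) , (0 , suc l0) ⟧
sweep₁-empty {n} l0 h0 l1 h1 l0<h0 h0≤n h1≤l1 = sweep-phases r1 ⟦ σ ⟧ (≡⇒≐ (cong ⟦_⟧ (sym (phase-A (<-≤-trans l0<h0 h0≤n))))) step
  where
  σ : Shape
  σ = (l0 , h0) , (l1 , h1)
  A C : ℕ → Shape
  A _ = σ
  C u = (l0 , h0) , (u , suc l0)
  open ThreePhase l0 l0 A A C
  step : ∀ (x : Fin n) → toggle′ (r1 , x) ⟦ St (suc (toℕ x)) ⟧ ≐ ⟦ St (toℕ x) ⟧
  step x with <-cmp (toℕ x) l0
  ... | tri> _ _ p = toggle′-via (r1 , x) σ σ (phase-A (<-trans p (n<1+n _))) (phase-A p)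
                       (toggle-shape-reject σ r1 x (toℕ x , suc (toℕ x)) (fill-empty h1≤l1)
                         (shape-¬intervalClosed l0 h0 (toℕ x) (suc (toℕ x)) h0≤n (toℕ<n x) l0<h0 (n<1+n _) (<-trans p (n<1+n _)) (inj₁ p)))
  ... | tri≈ _ p _ = toggle′-via (r1 , x) σ ((l0 , h0) , (toℕ x , suc (toℕ x)))
                       (phase-A (subst (_< suc (toℕ x)) p (n<1+n _)))
                       (trans (phase-C (≤-reflexive p) (≤-reflexive p)) (cong (λ m → (l0 , h0) , (toℕ x , suc m)) (sym p)))
                       (toggle-shape-accept σ r1 x (toℕ x , suc (toℕ x)) (fill-empty h1≤l1)
                         (inj₂ (inj₂ (≤-reflexive p , subst (λ m → suc m ≤ h0) (sym p) l0<h0))))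
  ... | tri< p _ _ = toggle′-via (r1 , x) (C (suc (toℕ x))) (C (toℕ x)) (phase-C p p) (phase-C (<⇒≤ p) (<⇒≤ p))
                       (toggle-shape-accept (C (suc (toℕ x))) r1 x (toℕ x , suc l0) (grow-bottom (s≤s (<⇒≤ p)))
                         (inj₂ (inj₂ (<⇒≤ p , l0<h0))))

sweep₁-sameEnd : ∀ {n} l0 h0 l1 → l0 < h0 → h0 ≤ n → l1 < h0 → l1 ≤ l0 →
  sweep r1 (allFin n) ⟦ (l0 , h0) , (l1 , h0) ⟧ ≐ ⟦ (l0 , h0) , (0 , l1) ⟧
sweep₁-sameEnd {n} l0 h0 l1 l0<h0 h0≤n l1<h0 l1≤l0 = sweep-phases r1 ⟦ σ ⟧ init step
  where
  σ : Shape
  σ = (l0 , h0) , (l1 , h0)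
  A B C : ℕ → Shape
  A _ = σ
  B u = (l0 , h0) , (l1 , u)
  C u = (l0 , h0) , (u , l1)
  open ThreePhase h0 l1 A B C
  init : ⟦ σ ⟧ ≐ ⟦ St n ⟧
  init with <-cmp h0 n
  ... | tri< q _ _ = ≡⇒≐ (cong ⟦_⟧ (sym (phase-A q)))
  ... | tri≈ _ refl _ = ≡⇒≐ (cong ⟦_⟧ (sym (phase-B l1<h0 ≤-refl)))
  ... | tri> _ _ q = ⊥-elim (<⇒≱ q h0≤n)
  step : ∀ (x : Fin n) → toggle′ (r1 , x) ⟦ St (suc (toℕ x)) ⟧ ≐ ⟦ St (toℕ x) ⟧
  step x with <-cmp (toℕ x) h0
  ... | tri> _ _ p = toggle′-via (r1 , x) σ σ (phase-A (<-trans p (n<1+n _))) (phase-A p)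
                       (toggle-rejects-above σ r1 x {l1} {k} (cong (l1 ,_) h0≡1+k) (≤-pred (subst (l1 <_) h0≡1+k l1<h0)) (subst (_< toℕ x) h0≡1+k p))
    where
    k = proj₁ (pred-of l1<h0)
    h0≡1+k = proj₂ (pred-of l1<h0)
  ... | tri≈ _ p _ = toggle′-via (r1 , x) σ σ
                       (phase-A (subst (_< suc (toℕ x)) p (n<1+n _)))
                       (trans (phase-B (subst (l1 <_) (sym p) l1<h0) (≤-reflexive p)) (cong (λ m → (l0 , h0) , (l1 , m)) p))
                       (toggle-shape-reject σ r1 x (l1 , suc h0) (subst (DiffersAt (l1 , h0) (l1 , suc h0)) (sym p) (grow-top (<⇒≤ l1<h0)))
                         (shape-¬intervalClosed l0 h0 l1 (suc h0) h0≤n (subst (_< n) p (toℕ<n x)) l0<h0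
                           (<-trans l1<h0 (n<1+n _)) (<-trans l0<h0 (n<1+n _)) (inj₂ (n<1+n _))))
  ... | tri< p _ _ with <-cmp l1 (toℕ x)
  ...   | tri> _ _ q = toggle′-via (r1 , x) (C (suc (toℕ x))) (C (toℕ x)) (phase-C q p) (phase-C (<⇒≤ q) (<⇒≤ p))
                         (toggle-shape-accept (C (suc (toℕ x))) r1 x (toℕ x , l1) (grow-bottom q)
                           (inj₂ (inj₂ (≤-trans (<⇒≤ q) l1≤l0 , <⇒≤ l1<h0))))
  ...   | tri< q _ _ = toggle′-via (r1 , x) (B (suc (toℕ x))) (B (toℕ x)) (phase-B (<-trans q (n<1+n _)) p) (phase-B q (<⇒≤ p))
                         (toggle-shape-accept (B (suc (toℕ x))) r1 x (l1 , toℕ x) (shrink-top (<⇒≤ q))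
                           (inj₂ (inj₂ (l1≤l0 , <⇒≤ p))))
  ...   | tri≈ _ q _ = toggle′-via (r1 , x) (B (suc (toℕ x))) (B (toℕ x))
                         (phase-B (subst (_< suc (toℕ x)) (sym q) (n<1+n _)) p)
                         (trans (phase-C (≤-reflexive (sym q)) (<⇒≤ p)) (subst (λ m → C m ≡ B m) q refl))
                         (toggle-shape-accept (B (suc (toℕ x))) r1 x (l1 , toℕ x) (shrink-top (≤-reflexive q))
                           (inj₂ (inj₂ (l1≤l0 , <⇒≤ p))))

sweep₁-sameStart : ∀ {n} l0 h0 k → l0 ≤ k → suc k < h0 → h0 ≤ n →
  sweep r1 (allFin n) ⟦ (l0 , h0) , (l0 , suc k) ⟧ ≐ ⟦ (l0 , h0) , (0 , suc (suc k)) ⟧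
sweep₁-sameStart {n} l0 h0 k l0≤k h1<h0 h0≤n = sweep-phases r1 ⟦ σ ⟧ (≡⇒≐ (cong ⟦_⟧ (sym (phase-A h1<n)))) step
  where
  h1 = suc k
  σ grown : Shape
  σ = (l0 , h0) , (l0 , h1)
  grown = (l0 , h0) , (l0 , suc h1)
  A B C : ℕ → Shape
  A _ = σ
  B _ = grown
  C u = (l0 , h0) , (u , suc h1)
  open ThreePhase h1 l0 A B C
  h1<n : h1 < n
  h1<n = ≤-trans h1<h0 h0≤n
  step : ∀ (x : Fin n) → toggle′ (r1 , x) ⟦ St (suc (toℕ x)) ⟧ ≐ ⟦ St (toℕ x) ⟧
  step x with <-cmp (toℕ x) h1
  ... | tri> _ _ p = toggle′-via (r1 , x) σ σ (phase-A (<-trans p (n<1+n _))) (phase-A p)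
                       (toggle-rejects-above σ r1 x refl l0≤k p)
  ... | tri≈ _ p _ = toggle′-via (r1 , x) σ grown
                       (phase-A (subst (_< suc (toℕ x)) p (n<1+n _))) (phase-B (subst (l0 <_) (sym p) (s≤s l0≤k)) (≤-reflexive p))
                       (toggle-shape-accept σ r1 x (l0 , suc h1) (subst (DiffersAt (l0 , h1) (l0 , suc h1)) (sym p) (grow-top (≤-trans l0≤k (n≤1+n k))))
                         (inj₂ (inj₂ (≤-refl , h1<h0))))
  ... | tri< p _ _ with <-cmp l0 (toℕ x)
  ...   | tri< q _ _ = toggle′-via (r1 , x) grown grown (phase-B (<-trans q (n<1+n _)) p) (phase-B q (<⇒≤ p))
                         (toggle-rejects-inside grown r1 x refl q (s≤s p) h1<n)
  ...   | tri≈ _ q _ = toggle′-via (r1 , x) grown grown (phase-B (subst (_< suc (toℕ x)) (sym q) (n<1+n _)) p)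
                         (trans (phase-C (≤-reflexive (sym q)) (<⇒≤ p)) (subst (λ m → C m ≡ grown) q refl))
                         (toggle-shape-reject grown r1 x (suc l0 , suc h1)
                           (subst (DiffersAt (l0 , suc h1) (suc l0 , suc h1)) q (shrink-bottom (s≤s (≤-trans l0≤k (n≤1+n k)))))
                           (shape-¬intervalClosed l0 h0 (suc l0) (suc h1) h0≤n h1<n (≤-<-trans l0≤k (<-trans (n<1+n k) h1<h0))
                             (s≤s (s≤s l0≤k)) (s≤s (≤-trans l0≤k (n≤1+n k))) (inj₁ (n<1+n _))))
  ...   | tri> _ _ q = toggle′-via (r1 , x) (C (suc (toℕ x))) (C (toℕ x)) (phase-C q p) (phase-C (<⇒≤ q) (<⇒≤ p))
                         (toggle-shape-accept (C (suc (toℕ x))) r1 x (toℕ x , suc h1) (grow-bottom (≤-trans p (n≤1+n _)))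
                           (inj₂ (inj₂ (<⇒≤ q , h1<h0))))

sweep₁-bothEmpty : ∀ {n} l0 h0 l1 h1 → h0 ≤ l0 → h1 ≤ l1 →
  sweep r1 (allFin n) ⟦ (l0 , h0) , (l1 , h1) ⟧ ≐ ⟦ (l0 , h0) , (0 , n) ⟧
sweep₁-bothEmpty {n} l0 h0 l1 h1 h0≤l0 h1≤l1 =
  sweep-through r1 St ⟦ (l0 , h0) , (l1 , h1) ⟧ (⟦⟧-replace-empty r1 ((l0 , h0) , (l1 , h1)) refl h1≤l1 ≤-refl) step
  where
  St : ℕ → Shape
  St u = (l0 , h0) , (u , n)
  step : ∀ (x : Fin n) → toggle′ (r1 , x) ⟦ St (suc (toℕ x)) ⟧ ≐ ⟦ St (toℕ x) ⟧
  step x = toggle′-via (r1 , x) (St (suc (toℕ x))) (St (toℕ x)) refl refl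
             (toggle-shape-accept (St (suc (toℕ x))) r1 x (toℕ x , n) (grow-bottom (toℕ<n x)) (inj₁ h0≤l0))

sweep₁-full : ∀ {n} l0 h0 l1 → h0 ≤ l0 → l1 < n →
  sweep r1 (allFin n) ⟦ (l0 , h0) , (l1 , n) ⟧ ≐ ⟦ (l0 , h0) , (0 , l1) ⟧
sweep₁-full {n} l0 h0 l1 h0≤l0 l1<n = sweep-phases r1 ⟦ σ ⟧ (≡⇒≐ (cong ⟦_⟧ (sym (phase-B l1<n ≤-refl)))) step
  where
  σ : Shape
  σ = (l0 , h0) , (l1 , n)
  B C : ℕ → Shape
  B u = (l0 , h0) , (l1 , u)
  C u = (l0 , h0) , (u , l1)
  open ThreePhase n l1 B B C
  step : ∀ (x : Fin n) → toggle′ (r1 , x) ⟦ St (suc (toℕ x)) ⟧ ≐ ⟦ St (toℕ x) ⟧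
  step x with <-cmp l1 (toℕ x)
  ... | tri> _ _ q = toggle′-via (r1 , x) (C (suc (toℕ x))) (C (toℕ x)) (phase-C q (toℕ<n x)) (phase-C (<⇒≤ q) (<⇒≤ (toℕ<n x)))
                       (toggle-shape-accept (C (suc (toℕ x))) r1 x (toℕ x , l1) (grow-bottom q) (inj₁ h0≤l0))
  ... | tri< q _ _ = toggle′-via (r1 , x) (B (suc (toℕ x))) (B (toℕ x)) (phase-B (<-trans q (n<1+n _)) (toℕ<n x)) (phase-B q (<⇒≤ (toℕ<n x)))
                       (toggle-shape-accept (B (suc (toℕ x))) r1 x (l1 , toℕ x) (shrink-top (<⇒≤ q)) (inj₁ h0≤l0))
  ... | tri≈ _ q _ = toggle′-via (r1 , x) (B (suc (toℕ x))) (B (toℕ x))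
                       (phase-B (subst (_< suc (toℕ x)) (sym q) (n<1+n _)) (toℕ<n x))
                       (trans (phase-C (≤-reflexive (sym q)) (<⇒≤ (toℕ<n x))) (subst (λ m → C m ≡ B m) q refl))
                       (toggle-shape-accept (B (suc (toℕ x))) r1 x (l1 , toℕ x) (shrink-top (≤-reflexive q)) (inj₁ h0≤l0))

sweep₀-empty : ∀ {n} l0 h0 l1 k → h0 ≤ l0 → l1 ≤ k → suc k ≤ n →
  sweep r0 (allFin n) ⟦ (l0 , h0) , (l1 , suc k) ⟧ ≐ ⟦ (l1 , n) , (l1 , suc k) ⟧
sweep₀-empty {n} l0 h0 l1 k h0≤l0 l1≤k h1≤n = sweep-phases r0 ⟦ σ ⟧ init step
  where
  h1 = suc k
  σ final : Shape
  σ = (l0 , h0) , (l1 , h1)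
  final = (l1 , n) , (l1 , h1)
  B C : ℕ → Shape
  B u = (u , n) , (l1 , h1)
  C _ = final
  open ThreePhase n l1 B B C
  l1<n : l1 < n
  l1<n = ≤-<-trans l1≤k h1≤n
  init : ⟦ σ ⟧ ≐ ⟦ St n ⟧
  init = ≐-trans (⟦⟧-replace-empty r0 σ refl h0≤l0 ≤-refl) (≡⇒≐ (cong ⟦_⟧ (sym (phase-B l1<n ≤-refl))))
  step : ∀ (x : Fin n) → toggle′ (r0 , x) ⟦ St (suc (toℕ x)) ⟧ ≐ ⟦ St (toℕ x) ⟧
  step x with <-cmp l1 (toℕ x)
  ... | tri< q _ _ = toggle′-via (r0 , x) (B (suc (toℕ x))) (B (toℕ x)) (phase-B (<-trans q (n<1+n _)) (toℕ<n x)) (phase-B q (<⇒≤ (toℕ<n x)))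
                       (toggle-shape-accept (B (suc (toℕ x))) r0 x (toℕ x , n) (grow-bottom (toℕ<n x)) (inj₂ (inj₂ (<⇒≤ q , h1≤n))))
  ... | tri≈ _ q _ = toggle′-via (r0 , x) (B (suc (toℕ x))) (B (toℕ x))
                       (phase-B (subst (_< suc (toℕ x)) (sym q) (n<1+n _)) (toℕ<n x))
                       (trans (phase-C (≤-reflexive (sym q)) (<⇒≤ (toℕ<n x))) (subst (λ m → final ≡ B m) q refl))
                       (toggle-shape-accept (B (suc (toℕ x))) r0 x (toℕ x , n) (grow-bottom (toℕ<n x)) (inj₂ (inj₂ (≤-reflexive q , h1≤n))))
  ... | tri> _ _ q with <-cmp (suc (toℕ x)) l1
  ...   | tri< r _ _ = toggle′-via (r0 , x) final final (phase-C q (toℕ<n x)) (phase-C (<⇒≤ q) (<⇒≤ (toℕ<n x)))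
                         (toggle-rejects-below final r0 x refl l1<n ≤-refl r)
  ...   | tri> _ _ r = ⊥-elim (<⇒≱ r q)
  ...   | tri≈ _ r _ = toggle′-via (r0 , x) final final (phase-C q (toℕ<n x)) (phase-C (<⇒≤ q) (<⇒≤ (toℕ<n x)))
                         (toggle-shape-reject final r0 x (toℕ x , n) (subst (λ m → DiffersAt (m , n) (toℕ x , n) (toℕ x)) r (grow-bottom (toℕ<n x)))
                           (shape-¬intervalClosed (toℕ x) n l1 h1 ≤-refl h1≤n (toℕ<n x) (s≤s l1≤k) (<-trans q (s≤s l1≤k)) (inj₁ q)))

sweep₀-bothEmpty : ∀ {n} l0 h0 l1 h1 → h0 ≤ l0 → h1 ≤ l1 →
  sweep r0 (allFin n) ⟦ (l0 , h0) , (l1 , h1) ⟧ ≐ ⟦ (0 , n) , (l1 , h1) ⟧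
sweep₀-bothEmpty {n} l0 h0 l1 h1 h0≤l0 h1≤l1 =
  sweep-through r0 St ⟦ (l0 , h0) , (l1 , h1) ⟧ (⟦⟧-replace-empty r0 ((l0 , h0) , (l1 , h1)) refl h0≤l0 ≤-refl) step
  where
  St : ℕ → Shape
  St u = (u , n) , (l1 , h1)
  step : ∀ (x : Fin n) → toggle′ (r0 , x) ⟦ St (suc (toℕ x)) ⟧ ≐ ⟦ St (toℕ x) ⟧
  step x = toggle′-via (r0 , x) (St (suc (toℕ x))) (St (toℕ x)) refl refl
             (toggle-shape-accept (St (suc (toℕ x))) r0 x (toℕ x , n) (grow-bottom (toℕ<n x)) (inj₂ (inj₁ h1≤l1)))

sweep₀-full-alone : ∀ {n} l0 l1 h1 → h1 ≤ l1 → l0 < n →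
  sweep r0 (allFin n) ⟦ (l0 , n) , (l1 , h1) ⟧ ≐ ⟦ (0 , l0) , (l1 , h1) ⟧
sweep₀-full-alone {n} l0 l1 h1 h1≤l1 l0<n = sweep-phases r0 ⟦ σ ⟧ (≡⇒≐ (cong ⟦_⟧ (sym (phase-A l0<n)))) step
  where
  σ : Shape
  σ = (l0 , n) , (l1 , h1)
  A C : ℕ → Shape
  A u = (l0 , u) , (l1 , h1)
  C u = (u , l0) , (l1 , h1)
  open ThreePhase l0 l0 A A C
  step : ∀ (x : Fin n) → toggle′ (r0 , x) ⟦ St (suc (toℕ x)) ⟧ ≐ ⟦ St (toℕ x) ⟧
  step x with <-cmp (toℕ x) l0
  ... | tri> _ _ p = toggle′-via (r0 , x) (A (suc (toℕ x))) (A (toℕ x)) (phase-A (<-trans p (n<1+n _))) (phase-A p)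
                       (toggle-shape-accept (A (suc (toℕ x))) r0 x (l0 , toℕ x) (shrink-top (<⇒≤ p)) (inj₂ (inj₁ h1≤l1)))
  ... | tri≈ _ p _ = toggle′-via (r0 , x) (A (suc (toℕ x))) (A (toℕ x))
                       (phase-A (subst (_< suc (toℕ x)) p (n<1+n _)))
                       (trans (phase-C (≤-reflexive p) (≤-reflexive p)) (subst (λ m → C m ≡ A m) (sym p) refl))
                       (toggle-shape-accept (A (suc (toℕ x))) r0 x (l0 , toℕ x) (shrink-top (≤-reflexive (sym p))) (inj₂ (inj₁ h1≤l1)))
  ... | tri< p _ _ = toggle′-via (r0 , x) (C (suc (toℕ x))) (C (toℕ x)) (phase-C p p) (phase-C (<⇒≤ p) (<⇒≤ p))
                       (toggle-shape-accept (C (suc (toℕ x))) r0 x (toℕ x , l0) (grow-bottom p) (inj₂ (inj₁ h1≤l1)))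

sweep₀-full-overlap : ∀ {n} l0 l1 k → l1 ≤ l0 → l0 ≤ k → suc k ≤ n →
  sweep r0 (allFin n) ⟦ (l0 , n) , (l1 , suc k) ⟧ ≐ ⟦ (suc l0 , suc k) , (l1 , suc k) ⟧
sweep₀-full-overlap {n} l0 l1 k l1≤l0 l0≤k h1≤n = sweep-phases r0 ⟦ σ ⟧ (≡⇒≐ (cong ⟦_⟧ (sym (phase-A h1≤n)))) step
  where
  h1 = suc k
  σ trimmed final : Shape
  σ = (l0 , n) , (l1 , h1)
  trimmed = (l0 , h1) , (l1 , h1)
  final = (suc l0 , h1) , (l1 , h1)
  A B C : ℕ → Shape
  A u = (l0 , u) , (l1 , h1)
  B _ = trimmed
  C _ = final
  open ThreePhase k l0 A B C
  St-after-end : ∀ (x : Fin n) → toℕ x ≡ k → St (suc (toℕ x)) ≡ trimmed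
  St-after-end x p = trans (phase-A (subst (k <_) (cong suc (sym p)) (n<1+n _))) (subst (λ m → A (suc m) ≡ trimmed) (sym p) refl)
  trim : ∀ (x : Fin n) → l0 ≡ toℕ x → toggle (r0 , x) ⟦ trimmed ⟧ ≐ ⟦ final ⟧
  trim x q = toggle-shape-accept trimmed r0 x (suc l0 , h1)
               (subst (DiffersAt (l0 , h1) (suc l0 , h1)) q (shrink-bottom (s≤s l0≤k)))
               (inj₂ (inj₂ (≤-trans l1≤l0 (n≤1+n _) , ≤-refl)))
  step : ∀ (x : Fin n) → toggle′ (r0 , x) ⟦ St (suc (toℕ x)) ⟧ ≐ ⟦ St (toℕ x) ⟧
  step x with <-cmp (toℕ x) k
  ... | tri> _ _ p = toggle′-via (r0 , x) (A (suc (toℕ x))) (A (toℕ x)) (phase-A (<-trans p (n<1+n _))) (phase-A p)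
                       (toggle-shape-accept (A (suc (toℕ x))) r0 x (l0 , toℕ x) (shrink-top (≤-trans l0≤k (<⇒≤ p))) (inj₂ (inj₂ (l1≤l0 , p))))
  ... | tri≈ _ p _ with <-cmp l0 (toℕ x)
  ...   | tri< q _ _ = toggle′-via (r0 , x) trimmed trimmed (St-after-end x p) (phase-B q (≤-reflexive p))
                         (toggle-shape-reject trimmed r0 x (l0 , toℕ x)
                           (subst (λ m → DiffersAt (l0 , suc m) (l0 , toℕ x) (toℕ x)) p (shrink-top (<⇒≤ q)))
                           (shape-¬intervalClosed l0 (toℕ x) l1 h1 (<⇒≤ (toℕ<n x)) h1≤n q (s≤s (≤-trans l1≤l0 l0≤k)) (s≤s l0≤k)
                             (inj₂ (subst (_< suc k) (sym p) (n<1+n _)))))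
  ...   | tri≈ _ q _ = toggle′-via (r0 , x) trimmed final (St-after-end x p) (phase-C (≤-reflexive (sym q)) (≤-reflexive p)) (trim x q)
  ...   | tri> _ _ q = ⊥-elim (<⇒≱ q (subst (l0 ≤_) (sym p) l0≤k))
  step x | tri< p _ _ with <-cmp l0 (toℕ x)
  ...   | tri< q _ _ = toggle′-via (r0 , x) trimmed trimmed (phase-B (<-trans q (n<1+n _)) p) (phase-B q (<⇒≤ p))
                         (toggle-rejects-inside trimmed r0 x refl q (s≤s p) h1≤n)
  ...   | tri≈ _ q _ = toggle′-via (r0 , x) trimmed final (phase-B (subst (_< suc (toℕ x)) (sym q) (n<1+n _)) p)
                         (phase-C (≤-reflexive (sym q)) (<⇒≤ p)) (trim x q)
  ...   | tri> _ _ q with <-cmp l0 k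
  ...     | tri< r _ _ = toggle′-via (r0 , x) final final (phase-C q p) (phase-C (<⇒≤ q) (<⇒≤ p))
                           (toggle-rejects-below final r0 x refl (s≤s r) h1≤n (s≤s q))
  ...     | tri> _ _ r = ⊥-elim (<⇒≱ r l0≤k)
  ...     | tri≈ _ r _ = toggle′-via (r0 , x) final final (phase-C q p) (phase-C (<⇒≤ q) (<⇒≤ p))
                           (toggle-shape-reject final r0 x (toℕ x , suc (toℕ x)) (fill-empty (≤-reflexive (cong suc (sym r))))
                             (shape-¬intervalClosed (toℕ x) (suc (toℕ x)) l1 h1 (toℕ<n x) h1≤n (n<1+n _) (s≤s (≤-trans l1≤l0 l0≤k))
                               (<-trans p (n<1+n _)) (inj₂ (s≤s p))))

sweep₀-full-disjoint : ∀ {n} l0 l1 k → l1 ≤ k → suc k ≤ l0 → l0 < n →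
  sweep r0 (allFin n) ⟦ (l0 , n) , (l1 , suc k) ⟧ ≐ ⟦ (l1 , l0) , (l1 , suc k) ⟧
sweep₀-full-disjoint {n} l0 l1 k l1≤k h1≤l0 l0<n = sweep-phases r0 ⟦ σ ⟧ (≡⇒≐ (cong ⟦_⟧ (sym (phase-A l0<n)))) step
  where
  h1 = suc k
  σ final : Shape
  σ = (l0 , n) , (l1 , h1)
  final = (l1 , l0) , (l1 , h1)
  A B C : ℕ → Shape
  A u = (l0 , u) , (l1 , h1)
  B u = (u , l0) , (l1 , h1)
  C _ = final
  open ThreePhase l0 l1 A B C
  l1<l0 : l1 < l0
  l1<l0 = <-≤-trans (s≤s l1≤k) h1≤l0
  step : ∀ (x : Fin n) → toggle′ (r0 , x) ⟦ St (suc (toℕ x)) ⟧ ≐ ⟦ St (toℕ x) ⟧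
  step x with <-cmp (toℕ x) l0
  ... | tri> _ _ p = toggle′-via (r0 , x) (A (suc (toℕ x))) (A (toℕ x)) (phase-A (<-trans p (n<1+n _))) (phase-A p)
                       (toggle-shape-accept (A (suc (toℕ x))) r0 x (l0 , toℕ x) (shrink-top (<⇒≤ p))
                         (inj₂ (inj₂ (<⇒≤ l1<l0 , ≤-trans h1≤l0 (<⇒≤ p)))))
  ... | tri≈ _ p _ = toggle′-via (r0 , x) (A (suc (toℕ x))) (A (toℕ x))
                       (phase-A (subst (_< suc (toℕ x)) p (n<1+n _)))
                       (trans (phase-B (subst (l1 <_) (sym p) l1<l0) (≤-reflexive p)) (subst (λ m → B m ≡ A m) (sym p) refl))
                       (toggle-shape-accept (A (suc (toℕ x))) r0 x (l0 , toℕ x) (shrink-top (≤-reflexive (sym p)))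
                         (inj₂ (inj₂ (<⇒≤ l1<l0 , subst (h1 ≤_) (sym p) h1≤l0))))
  ... | tri< p _ _ with <-cmp l1 (toℕ x)
  ...   | tri< q _ _ = toggle′-via (r0 , x) (B (suc (toℕ x))) (B (toℕ x)) (phase-B (<-trans q (n<1+n _)) p) (phase-B q (<⇒≤ p))
                         (toggle-shape-accept (B (suc (toℕ x))) r0 x (toℕ x , l0) (grow-bottom p) (inj₂ (inj₂ (<⇒≤ q , h1≤l0))))
  ...   | tri≈ _ q _ = toggle′-via (r0 , x) (B (suc (toℕ x))) (B (toℕ x))
                         (phase-B (subst (_< suc (toℕ x)) (sym q) (n<1+n _)) p)
                         (trans (phase-C (≤-reflexive (sym q)) (<⇒≤ p)) (subst (λ m → final ≡ B m) q refl))
                         (toggle-shape-accept (B (suc (toℕ x))) r0 x (toℕ x , l0) (grow-bottom p) (inj₂ (inj₂ (≤-reflexive q , h1≤l0))))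
  ...   | tri> _ _ q with <-cmp (suc (toℕ x)) l1
  ...     | tri< r _ _ = toggle′-via (r0 , x) final final (phase-C q p) (phase-C (<⇒≤ q) (<⇒≤ p))
                           (toggle-rejects-below final r0 x refl l1<l0 (<⇒≤ l0<n) r)
  ...     | tri> _ _ r = ⊥-elim (<⇒≱ r q)
  ...     | tri≈ _ r _ = toggle′-via (r0 , x) final final (phase-C q p) (phase-C (<⇒≤ q) (<⇒≤ p))
                           (toggle-shape-reject final r0 x (toℕ x , l0) (subst (λ m → DiffersAt (m , l0) (toℕ x , l0) (toℕ x)) r (grow-bottom p))
                             (shape-¬intervalClosed (toℕ x) l0 l1 h1 (<⇒≤ l0<n) (≤-trans h1≤l0 (<⇒≤ l0<n)) p (s≤s l1≤k)
                               (<-trans q (s≤s l1≤k)) (inj₁ q)))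

-- Overhangs

𝟙 : ∀ {A : Set} → Dec A → ℕ
𝟙 a? = if does a? then 1 else 0

𝟙-yes : ∀ {A : Set} (a? : Dec A) → A → 𝟙 a? ≡ 1
𝟙-yes (yes _) _ = refl
𝟙-yes (no ¬a) a = ⊥-elim (¬a a)

𝟙-no : ∀ {A : Set} (a? : Dec A) → ¬ A → 𝟙 a? ≡ 0
𝟙-no (yes a) ¬a = ⊥-elim (¬a a)
𝟙-no (no _) _ = refl

𝟙-⇔ : ∀ {A B : Set} (a? : Dec A) (b? : Dec B) → (A → B) → (B → A) → 𝟙 a? ≡ 𝟙 b?
𝟙-⇔ (yes a) b? f g = sym (𝟙-yes b? (f a))
𝟙-⇔ (no ¬a) b? f g = sym (𝟙-no b? (λ b → ¬a (g b)))

LeftOverhang : ∀ {n} → Subset n → Set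
LeftOverhang I = ∃ λ b → ∃ λ d →
  (I (r0 , b) ≡ true) × (I (r1 , b) ≡ true) × (I (r1 , d) ≡ true) × (I (r0 , d) ≡ false) × (toℕ d ≤ toℕ b)

RightOverhang : ∀ {n} → Subset n → Set
RightOverhang I = ∃ λ b → ∃ λ d →
  (I (r0 , b) ≡ true) × (I (r1 , b) ≡ true) × (I (r0 , d) ≡ true) × (I (r1 , d) ≡ false) × (toℕ b ≤ toℕ d)

leftOverhang? : ∀ {n} (I : Subset n) → Dec (LeftOverhang I)
leftOverhang? I = any? λ b → any? λ d →
  (I (r0 , b) ≟ᵇ true) ×-dec (I (r1 , b) ≟ᵇ true) ×-dec (I (r1 , d) ≟ᵇ true) ×-dec (I (r0 , d) ≟ᵇ false) ×-dec (toℕ d ≤? toℕ b)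

rightOverhang? : ∀ {n} (I : Subset n) → Dec (RightOverhang I)
rightOverhang? I = any? λ b → any? λ d →
  (I (r0 , b) ≟ᵇ true) ×-dec (I (r1 , b) ≟ᵇ true) ×-dec (I (r0 , d) ≟ᵇ true) ×-dec (I (r1 , d) ≟ᵇ false) ×-dec (toℕ b ≤? toℕ d)

leftOverhang-resp-≐ : ∀ {n} {I J : Subset n} → I ≐ J → LeftOverhang I → LeftOverhang J
leftOverhang-resp-≐ e (b , d , p₁ , p₂ , p₃ , p₄ , d≤b) =
  b , d , trans (sym (e _)) p₁ , trans (sym (e _)) p₂ , trans (sym (e _)) p₃ , trans (sym (e _)) p₄ , d≤b

rightOverhang-resp-≐ : ∀ {n} {I J : Subset n} → I ≐ J → RightOverhang I → RightOverhang J
rightOverhang-resp-≐ e (b , d , p₁ , p₂ , p₃ , p₄ , b≤d) =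
  b , d , trans (sym (e _)) p₁ , trans (sym (e _)) p₂ , trans (sym (e _)) p₃ , trans (sym (e _)) p₄ , b≤d

opaque
  #leftOverhang #rightOverhang : ∀ {n} → Subset n → ℕ
  #leftOverhang I = 𝟙 (leftOverhang? I)
  #rightOverhang I = 𝟙 (rightOverhang? I)

  #leftOverhang-cong : ∀ {n} {I J : Subset n} → I ≐ J → #leftOverhang I ≡ #leftOverhang J
  #leftOverhang-cong {I = I} {J} e =
    𝟙-⇔ (leftOverhang? I) (leftOverhang? J) (leftOverhang-resp-≐ e) (leftOverhang-resp-≐ (≐-sym e))

  #rightOverhang-cong : ∀ {n} {I J : Subset n} → I ≐ J → #rightOverhang I ≡ #rightOverhang J
  #rightOverhang-cong {I = I} {J} e =
    𝟙-⇔ (rightOverhang? I) (rightOverhang? J) (rightOverhang-resp-≐ e) (rightOverhang-resp-≐ (≐-sym e))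

LeftOverhangShape : Shape → Set
LeftOverhangShape ((l0 , h0) , (l1 , h1)) = (l0 < h0) × (l1 < h1) × (l0 < h1) × (l1 < l0)

RightOverhangShape : Shape → Set
RightOverhangShape ((l0 , h0) , (l1 , h1)) = (l0 < h0) × (l1 < h1) × (l0 < h1) × (h1 < h0)

leftOverhang⇒shape : ∀ {n} σ → LeftOverhang {n} ⟦ σ ⟧ → LeftOverhangShape σ
leftOverhang⇒shape ((l0 , h0) , (l1 , h1)) (b , d , p₁ , p₂ , p₃ , p₄ , d≤b) =
  let (a₁ , b₁) = inInterval-bounds {l0} {h0} p₁ ; (a₂ , b₂) = inInterval-bounds {l1} {h1} p₂
      (a₃ , _) = inInterval-bounds {l1} {h1} p₃
      d<l0 : toℕ d < l0
      d<l0 = ≰⇒> (λ q → <⇒≱ (≤-<-trans d≤b b₁) (inInterval-false {l0} {h0} p₄ q))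
  in ≤-<-trans a₁ b₁ , ≤-<-trans a₂ b₂ , ≤-<-trans a₁ b₂ , ≤-<-trans a₃ d<l0

shape⇒leftOverhang : ∀ {n} σ → proj₂ (proj₁ σ) ≤ n → LeftOverhangShape σ → LeftOverhang {n} ⟦ σ ⟧
shape⇒leftOverhang {n} ((l0 , h0) , (l1 , h1)) h0≤n (l0<h0 , l1<h1 , l0<h1 , l1<l0) =
  fromℕ< p , fromℕ< q ,
  trans (⟦⟧-cell σ r0 p) (inInterval-true ≤-refl l0<h0) ,
  trans (⟦⟧-cell σ r1 p) (inInterval-true (<⇒≤ l1<l0) l0<h1) ,
  trans (⟦⟧-cell σ r1 q) (inInterval-true ≤-refl l1<h1) ,
  trans (⟦⟧-cell σ r0 q) (inInterval-below {l0} {h0} l1<l0) ,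
  subst₂ _≤_ (sym (toℕ-fromℕ< q)) (sym (toℕ-fromℕ< p)) (<⇒≤ l1<l0)
  where
  σ = (l0 , h0) , (l1 , h1)
  p : l0 < n
  p = <-≤-trans l0<h0 h0≤n
  q : l1 < n
  q = <-trans l1<l0 p

rightOverhang⇒shape : ∀ {n} σ → RightOverhang {n} ⟦ σ ⟧ → RightOverhangShape σ
rightOverhang⇒shape ((l0 , h0) , (l1 , h1)) (b , d , p₁ , p₂ , p₃ , p₄ , b≤d) =
  let (a₁ , b₁) = inInterval-bounds {l0} {h0} p₁ ; (a₂ , b₂) = inInterval-bounds {l1} {h1} p₂
      (_ , b₃) = inInterval-bounds {l0} {h0} p₃
  in ≤-<-trans a₁ b₁ , ≤-<-trans a₂ b₂ , ≤-<-trans a₁ b₂ ,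
     ≤-<-trans (inInterval-false {l1} {h1} p₄ (≤-trans a₂ b≤d)) b₃

shape⇒rightOverhang : ∀ {n} σ → proj₂ (proj₁ σ) ≤ n → IsICShape σ → RightOverhangShape σ → RightOverhang {n} ⟦ σ ⟧
shape⇒rightOverhang {n} ((l0 , suc k) , (l1 , h1)) h0≤n ok (l0<h0 , l1<h1 , l0<h1 , s≤s h1≤k) =
  fromℕ< p , fromℕ< h0≤n ,
  trans (⟦⟧-cell σ r0 p) (inInterval-true ≤-refl l0<h0) ,
  trans (⟦⟧-cell σ r1 p) (inInterval-true (l1≤l0 ok) l0<h1) ,
  trans (⟦⟧-cell σ r0 h0≤n) (inInterval-true (≤-pred l0<h0) ≤-refl) ,
  trans (⟦⟧-cell σ r1 h0≤n) (inInterval-above {l1} {h1} h1≤k) ,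
  subst₂ _≤_ (sym (toℕ-fromℕ< p)) (sym (toℕ-fromℕ< h0≤n)) (≤-pred l0<h0)
  where
  σ = (l0 , suc k) , (l1 , h1)
  p : l0 < n
  p = <-≤-trans l0<h0 h0≤n
  l1≤l0 : IsICShape σ → l1 ≤ l0
  l1≤l0 (inj₁ e) = ⊥-elim (<⇒≱ l0<h0 e)
  l1≤l0 (inj₂ (inj₁ e)) = ⊥-elim (<⇒≱ l1<h1 e)
  l1≤l0 (inj₂ (inj₂ (l1≤l0 , _))) = l1≤l0

opaque
  unfolding #leftOverhang

  #leftOverhang-shape-yes : ∀ {n} σ → proj₂ (proj₁ σ) ≤ n → LeftOverhangShape σ → #leftOverhang {n} ⟦ σ ⟧ ≡ 1
  #leftOverhang-shape-yes {n} σ h0≤n c = 𝟙-yes (leftOverhang? (⟦_⟧ {n} σ)) (shape⇒leftOverhang σ h0≤n c)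

  #leftOverhang-shape-no : ∀ {n} σ → ¬ LeftOverhangShape σ → #leftOverhang {n} ⟦ σ ⟧ ≡ 0
  #leftOverhang-shape-no {n} σ ¬c = 𝟙-no (leftOverhang? (⟦_⟧ {n} σ)) (λ p → ¬c (leftOverhang⇒shape σ p))

  #rightOverhang-shape-yes : ∀ {n} σ → proj₂ (proj₁ σ) ≤ n → IsICShape σ → RightOverhangShape σ → #rightOverhang {n} ⟦ σ ⟧ ≡ 1
  #rightOverhang-shape-yes {n} σ h0≤n ok c = 𝟙-yes (rightOverhang? (⟦_⟧ {n} σ)) (shape⇒rightOverhang σ h0≤n ok c)

  #rightOverhang-shape-no : ∀ {n} σ → ¬ RightOverhangShape σ → #rightOverhang {n} ⟦ σ ⟧ ≡ 0
  #rightOverhang-shape-no {n} σ ¬c = 𝟙-no (rightOverhang? (⟦_⟧ {n} σ)) (λ p → ¬c (rightOverhang⇒shape σ p))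

  #left≡#right : ∀ {n} σ σ′ → proj₂ (proj₁ σ) ≤ n → IsICShape σ → proj₂ (proj₁ σ′) ≤ n →
    (RightOverhangShape σ → LeftOverhangShape σ′) → (LeftOverhangShape σ′ → RightOverhangShape σ) →
    #leftOverhang {n} ⟦ σ′ ⟧ ≡ #rightOverhang {n} ⟦ σ ⟧
  #left≡#right σ σ′ h0≤n ok h0′≤n f g = 𝟙-⇔ (leftOverhang? ⟦ σ′ ⟧) (rightOverhang? ⟦ σ ⟧)
    (λ p → shape⇒rightOverhang σ h0≤n ok (g (leftOverhang⇒shape σ′ p)))
    (λ p → shape⇒leftOverhang σ′ h0′≤n (f (rightOverhang⇒shape σ p)))

-- Rowmotion on shapes

record RowmotionStep (n : ℕ) (σ : Shape) : Set where
  field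
    next : Shape
    next-bounded₀ : proj₂ (proj₁ next) ≤ n
    next-bounded₁ : proj₂ (proj₂ next) ≤ n
    sweeps≐next : sweep r0 (allFin n) (sweep r1 (allFin n) ⟦ σ ⟧) ≐ ⟦ next ⟧
    #left-next≡#right : #leftOverhang {n} ⟦ next ⟧ ≡ #rightOverhang {n} ⟦ σ ⟧

via-sweeps : ∀ {n} σ τ σ′ → proj₂ (proj₁ σ) ≤ n → IsICShape σ → proj₂ (proj₁ σ′) ≤ n → proj₂ (proj₂ σ′) ≤ n →
  sweep r1 (allFin n) ⟦ σ ⟧ ≐ ⟦ τ ⟧ → sweep r0 (allFin n) ⟦ τ ⟧ ≐ ⟦ σ′ ⟧ →
  (RightOverhangShape σ → LeftOverhangShape σ′) → (LeftOverhangShape σ′ → RightOverhangShape σ) → RowmotionStep n σ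
via-sweeps {n} σ τ σ′ h0≤n ok h0′≤n h1′≤n sweep₁ sweep₀ f g = record
  { next = σ′
  ; next-bounded₀ = h0′≤n
  ; next-bounded₁ = h1′≤n
  ; sweeps≐next = ≐-trans (sweep-cong r0 (allFin n) sweep₁) sweep₀
  ; #left-next≡#right = #left≡#right σ σ′ h0≤n ok h0′≤n f g
  }

rowmotion-empty : ∀ m l0 h0 l1 h1 → h0 ≤ l0 → h0 ≤ suc m → h1 ≤ l1 →
  RowmotionStep (suc m) ((l0 , h0) , (l1 , h1))
rowmotion-empty m l0 h0 l1 h1 h0≤l0 h0≤n h1≤l1 =
  via-sweeps _ _ ((0 , suc m) , (0 , suc m)) h0≤n (inj₁ h0≤l0) ≤-refl ≤-refl
    (sweep₁-bothEmpty l0 h0 l1 h1 h0≤l0 h1≤l1) (sweep₀-empty l0 h0 0 m h0≤l0 z≤n ≤-refl)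
    (λ (l0<h0 , _) → ⊥-elim (<⇒≱ l0<h0 h0≤l0)) (λ { (_ , _ , _ , ()) })

rowmotion-topFull-from0 : ∀ {n} l0 h0 → h0 ≤ l0 → h0 ≤ n → 0 < n →
  RowmotionStep n ((l0 , h0) , (0 , n))
rowmotion-topFull-from0 {n} l0 h0 h0≤l0 h0≤n 0<n =
  via-sweeps _ _ ((0 , n) , (0 , 0)) h0≤n (inj₁ h0≤l0) ≤-refl z≤n
    (sweep₁-full l0 h0 0 h0≤l0 0<n) (sweep₀-bothEmpty l0 h0 0 0 h0≤l0 z≤n)
    (λ (l0<h0 , _) → ⊥-elim (<⇒≱ l0<h0 h0≤l0)) (λ { (_ , _ , _ , ()) })

rowmotion-topFull : ∀ {n} l0 h0 k → h0 ≤ l0 → h0 ≤ n → suc k < n →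
  RowmotionStep n ((l0 , h0) , (suc k , n))
rowmotion-topFull {n} l0 h0 k h0≤l0 h0≤n l1<n =
  via-sweeps _ _ ((0 , n) , (0 , suc k)) h0≤n (inj₁ h0≤l0) ≤-refl (<⇒≤ l1<n)
    (sweep₁-full l0 h0 (suc k) h0≤l0 l1<n) (sweep₀-empty l0 h0 0 k h0≤l0 z≤n (<⇒≤ l1<n))
    (λ (l0<h0 , _) → ⊥-elim (<⇒≱ l0<h0 h0≤l0)) (λ { (_ , _ , _ , ()) })

rowmotion-topOnly : ∀ {n} l0 h0 l1 k → h0 ≤ l0 → h0 ≤ n → l1 ≤ k → suc (suc k) ≤ n →
  RowmotionStep n ((l0 , h0) , (l1 , suc k))
rowmotion-topOnly {n} l0 h0 l1 k h0≤l0 h0≤n l1≤k h1<n =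
  via-sweeps _ _ ((suc l1 , n) , (suc l1 , suc (suc k))) h0≤n (inj₁ h0≤l0) ≤-refl h1<n
    (sweep-shift r1 σ refl l1≤k h1<n (inj₁ h0≤l0) (inj₁ h0≤l0)) (sweep₀-empty l0 h0 (suc l1) (suc k) h0≤l0 (s≤s l1≤k) h1<n)
    (λ (l0<h0 , _) → ⊥-elim (<⇒≱ l0<h0 h0≤l0)) (λ (_ , _ , _ , c) → ⊥-elim (n≮n _ c))
  where σ = (l0 , h0) , (l1 , suc k)

rowmotion-bottomOnly : ∀ {n} l0 k0 l1 h1 → l0 ≤ k0 → suc (suc k0) ≤ n → h1 ≤ l1 →
  RowmotionStep n ((l0 , suc k0) , (l1 , h1))
rowmotion-bottomOnly {n} l0 k0 l1 h1 l0≤k0 h0<n h1≤l1 =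
  via-sweeps _ _ ((suc l0 , suc (suc k0)) , (0 , suc l0)) (<⇒≤ h0<n) (inj₂ (inj₁ h1≤l1)) h0<n (≤-trans (s≤s l0≤k0) (<⇒≤ h0<n))
    (sweep₁-empty l0 (suc k0) l1 h1 (s≤s l0≤k0) (<⇒≤ h0<n) h1≤l1)
    (sweep-shift r0 ((l0 , suc k0) , (0 , suc l0)) refl l0≤k0 h0<n
      (inj₂ (inj₂ (z≤n , s≤s (≤-trans l0≤k0 (n≤1+n _))))) (inj₂ (inj₂ (z≤n , s≤s (≤-trans l0≤k0 (n≤1+n _))))))
    (λ (_ , l1<h1 , _) → ⊥-elim (<⇒≱ l1<h1 h1≤l1)) (λ (_ , _ , c , _) → ⊥-elim (n≮n _ c))

rowmotion-bottomOnly-full : ∀ l0 k0 l1 h1 → l0 ≤ k0 → h1 ≤ l1 →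
  RowmotionStep (suc k0) ((l0 , suc k0) , (l1 , h1))
rowmotion-bottomOnly-full l0 k0 l1 h1 l0≤k0 h1≤l1 =
  via-sweeps _ _ ((suc l0 , suc l0) , (0 , suc l0)) ≤-refl (inj₂ (inj₁ h1≤l1)) (s≤s l0≤k0) (s≤s l0≤k0)
    (sweep₁-empty l0 (suc k0) l1 h1 (s≤s l0≤k0) ≤-refl h1≤l1) (sweep₀-full-overlap l0 0 l0 z≤n ≤-refl (s≤s l0≤k0))
    (λ (_ , l1<h1 , _) → ⊥-elim (<⇒≱ l1<h1 h1≤l1)) (λ (c , _) → ⊥-elim (n≮n _ c))

rowmotion-sameEnd : ∀ {n} l0 k l1 → l0 ≤ k → l1 ≤ l0 → suc (suc k) ≤ n →
  RowmotionStep n ((l0 , suc k) , (l1 , suc k))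
rowmotion-sameEnd {n} l0 k l1 l0≤k l1≤l0 h0<n =
  via-sweeps _ _ ((suc l0 , suc (suc k)) , (0 , l1)) (<⇒≤ h0<n) (inj₂ (inj₂ (l1≤l0 , ≤-refl))) h0<n
    (≤-trans l1≤h0 (<⇒≤ h0<n))
    (sweep₁-sameEnd l0 (suc k) l1 (s≤s l0≤k) (<⇒≤ h0<n) (s≤s (≤-trans l1≤l0 l0≤k)) l1≤l0)
    (sweep-shift r0 ((l0 , suc k) , (0 , l1)) refl l0≤k h0<n
      (inj₂ (inj₂ (z≤n , ≤-trans l1≤h0 (n≤1+n _)))) (inj₂ (inj₂ (z≤n , ≤-trans l1≤h0 (n≤1+n _)))))
    (λ (_ , _ , _ , c) → ⊥-elim (n≮n _ c)) (λ (_ , _ , c , _) → ⊥-elim (<⇒≱ c (≤-trans l1≤l0 (n≤1+n _))))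
  where
  l1≤h0 : l1 ≤ suc k
  l1≤h0 = ≤-trans l1≤l0 (≤-trans l0≤k (n≤1+n k))

rowmotion-sameEnd-full-from0 : ∀ l0 k → l0 ≤ k → RowmotionStep (suc k) ((l0 , suc k) , (0 , suc k))
rowmotion-sameEnd-full-from0 l0 k l0≤k =
  via-sweeps _ _ ((0 , l0) , (0 , 0)) ≤-refl (inj₂ (inj₂ (z≤n , ≤-refl))) (<⇒≤ (s≤s l0≤k)) z≤n
    (sweep₁-sameEnd l0 (suc k) 0 (s≤s l0≤k) ≤-refl (s≤s z≤n) z≤n) (sweep₀-full-alone l0 0 0 z≤n (s≤s l0≤k))
    (λ (_ , _ , _ , c) → ⊥-elim (n≮n _ c)) (λ { (_ , () , _) })

rowmotion-sameEnd-full : ∀ l0 k j → l0 ≤ k → suc j ≤ l0 → RowmotionStep (suc k) ((l0 , suc k) , (suc j , suc k))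
rowmotion-sameEnd-full l0 k j l0≤k l1≤l0 =
  via-sweeps _ _ ((0 , l0) , (0 , suc j)) ≤-refl (inj₂ (inj₂ (l1≤l0 , ≤-refl))) l0≤n (≤-trans l1≤l0 l0≤n)
    (sweep₁-sameEnd l0 (suc k) (suc j) (s≤s l0≤k) ≤-refl (s≤s (≤-trans l1≤l0 l0≤k)) l1≤l0)
    (sweep₀-full-disjoint l0 0 j z≤n l1≤l0 (s≤s l0≤k))
    (λ (_ , _ , _ , c) → ⊥-elim (n≮n _ c)) (λ { (_ , _ , _ , ()) })
  where
  l0≤n : l0 ≤ suc k
  l0≤n = ≤-trans l0≤k (n≤1+n k)

rowmotion-leftOverhang : ∀ {n} l0 k0 l1 k1 → l0 ≤ k0 → l1 ≤ k1 → l1 < l0 → k1 < k0 → suc (suc k0) ≤ n →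
  RowmotionStep n ((l0 , suc k0) , (l1 , suc k1))
rowmotion-leftOverhang {n} l0 k0 l1 k1 l0≤k0 l1≤k1 l1<l0 k1<k0 h0<n =
  via-sweeps σ _ ((suc l0 , suc (suc k0)) , (suc l1 , suc (suc k1))) (<⇒≤ h0<n) (inj₂ (inj₂ (<⇒≤ l1<l0 , s≤s (<⇒≤ k1<k0))))
    h0<n (≤-trans (s≤s k1<k0) (<⇒≤ h0<n))
    (sweep-shift r1 σ refl l1≤k1 (≤-trans (s≤s k1<k0) (<⇒≤ h0<n))
      (inj₂ (inj₂ (<⇒≤ l1<l0 , s≤s k1<k0))) (inj₂ (inj₂ (l1<l0 , s≤s k1<k0))))
    (sweep-shift r0 ((l0 , suc k0) , (suc l1 , suc (suc k1))) refl l0≤k0 h0<n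
      (inj₂ (inj₂ (l1<l0 , ≤-trans (s≤s k1<k0) (n≤1+n _)))) (inj₂ (inj₂ (≤-trans l1<l0 (n≤1+n _) , ≤-trans (s≤s k1<k0) (n≤1+n _)))))
    (λ (c0 , c1 , c01 , _) → s≤s c0 , s≤s c1 , s≤s c01 , s≤s l1<l0)
    (λ (c0 , c1 , c01 , _) → ≤-pred c0 , ≤-pred c1 , ≤-pred c01 , s≤s k1<k0)
  where σ = (l0 , suc k0) , (l1 , suc k1)

rowmotion-leftOverhang-full-disjoint : ∀ l0 k0 l1 k1 → l0 ≤ k0 → l1 ≤ k1 → l1 < l0 → k1 < k0 → suc k1 < l0 →
  RowmotionStep (suc k0) ((l0 , suc k0) , (l1 , suc k1))
rowmotion-leftOverhang-full-disjoint l0 k0 l1 k1 l0≤k0 l1≤k1 l1<l0 k1<k0 h1<l0 =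
  via-sweeps σ _ ((suc l1 , l0) , (suc l1 , suc (suc k1))) ≤-refl (inj₂ (inj₂ (<⇒≤ l1<l0 , s≤s (<⇒≤ k1<k0))))
    (<⇒≤ (s≤s l0≤k0)) (s≤s k1<k0)
    (sweep-shift r1 σ refl l1≤k1 (s≤s k1<k0) (inj₂ (inj₂ (<⇒≤ l1<l0 , s≤s k1<k0))) (inj₂ (inj₂ (l1<l0 , s≤s k1<k0))))
    (sweep₀-full-disjoint l0 (suc l1) (suc k1) (s≤s l1≤k1) h1<l0 (s≤s l0≤k0))
    (λ (_ , _ , c01 , _) → ⊥-elim (<⇒≱ c01 (<⇒≤ h1<l0))) (λ (_ , _ , _ , c) → ⊥-elim (n≮n _ c))
  where σ = (l0 , suc k0) , (l1 , suc k1)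

rowmotion-leftOverhang-full-overlap : ∀ l0 k0 l1 k1 → l0 ≤ k0 → l1 ≤ k1 → l1 < l0 → k1 < k0 → l0 ≤ suc k1 →
  RowmotionStep (suc k0) ((l0 , suc k0) , (l1 , suc k1))
rowmotion-leftOverhang-full-overlap l0 k0 l1 k1 l0≤k0 l1≤k1 l1<l0 k1<k0 l0≤h1 =
  via-sweeps σ _ ((suc l0 , suc (suc k1)) , (suc l1 , suc (suc k1))) ≤-refl (inj₂ (inj₂ (<⇒≤ l1<l0 , s≤s (<⇒≤ k1<k0))))
    (s≤s k1<k0) (s≤s k1<k0)
    (sweep-shift r1 σ refl l1≤k1 (s≤s k1<k0) (inj₂ (inj₂ (<⇒≤ l1<l0 , s≤s k1<k0))) (inj₂ (inj₂ (l1<l0 , s≤s k1<k0))))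
    (sweep₀-full-overlap l0 (suc l1) (suc k1) l1<l0 l0≤h1 (s≤s k1<k0))
    (λ (_ , c1 , c01 , _) → s≤s c01 , s≤s c1 , s≤s c01 , s≤s l1<l0)
    (λ (_ , _ , c01 , _) → s≤s l0≤k0 , s≤s l1≤k1 , ≤-pred c01 , s≤s k1<k0)
  where σ = (l0 , suc k0) , (l1 , suc k1)

rowmotion-sameStart : ∀ {n} l0 k0 k1 → l0 ≤ k1 → k1 < k0 → suc (suc k0) ≤ n →
  RowmotionStep n ((l0 , suc k0) , (l0 , suc k1))
rowmotion-sameStart {n} l0 k0 k1 l0≤k1 k1<k0 h0<n =
  via-sweeps _ _ ((suc l0 , suc (suc k0)) , (0 , suc (suc k1))) (<⇒≤ h0<n) (inj₂ (inj₂ (≤-refl , s≤s (<⇒≤ k1<k0))))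
    h0<n (≤-trans (s≤s k1<k0) (<⇒≤ h0<n))
    (sweep₁-sameStart l0 (suc k0) k1 l0≤k1 (s≤s k1<k0) (<⇒≤ h0<n))
    (sweep-shift r0 ((l0 , suc k0) , (0 , suc (suc k1))) refl l0≤k0 h0<n
      (inj₂ (inj₂ (z≤n , ≤-trans (s≤s k1<k0) (n≤1+n _)))) (inj₂ (inj₂ (z≤n , ≤-trans (s≤s k1<k0) (n≤1+n _)))))
    (λ _ → s≤s (s≤s l0≤k0) , s≤s z≤n , s≤s (s≤s l0≤k1) , s≤s z≤n)
    (λ _ → s≤s l0≤k0 , s≤s l0≤k1 , s≤s l0≤k1 , s≤s k1<k0)
  where
  l0≤k0 : l0 ≤ k0
  l0≤k0 = ≤-trans l0≤k1 (<⇒≤ k1<k0)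

rowmotion-sameStart-full : ∀ l0 k0 k1 → l0 ≤ k1 → k1 < k0 → RowmotionStep (suc k0) ((l0 , suc k0) , (l0 , suc k1))
rowmotion-sameStart-full l0 k0 k1 l0≤k1 k1<k0 =
  via-sweeps _ _ ((suc l0 , suc (suc k1)) , (0 , suc (suc k1))) ≤-refl (inj₂ (inj₂ (≤-refl , s≤s (<⇒≤ k1<k0))))
    (s≤s k1<k0) (s≤s k1<k0)
    (sweep₁-sameStart l0 (suc k0) k1 l0≤k1 (s≤s k1<k0) ≤-refl)
    (sweep₀-full-overlap l0 0 (suc k1) z≤n (≤-trans l0≤k1 (n≤1+n _)) (s≤s k1<k0))
    (λ _ → s≤s (s≤s l0≤k1) , s≤s z≤n , s≤s (s≤s l0≤k1) , s≤s z≤n)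
    (λ _ → s≤s (≤-trans l0≤k1 (<⇒≤ k1<k0)) , s≤s l0≤k1 , s≤s l0≤k1 , s≤s k1<k0)

data Emptiness (l : ℕ) : ℕ → Set where
  empty : ∀ {h} → h ≤ l → Emptiness l h
  nonempty : ∀ {k} → l ≤ k → Emptiness l (suc k)

emptiness : ∀ l h → Emptiness l h
emptiness l zero = empty z≤n
emptiness l (suc k) with l ≤? k
... | yes l≤k = nonempty l≤k
... | no l≰k = empty (≰⇒> l≰k)

rowmotion-topOnly-any : ∀ {n} l0 h0 l1 k1 → h0 ≤ l0 → h0 ≤ n → l1 ≤ k1 → suc k1 ≤ n →
  RowmotionStep n ((l0 , h0) , (l1 , suc k1))
rowmotion-topOnly-any l0 h0 l1 k1 h0≤l0 h0≤n l1≤k1 h1≤n with m≤n⇒m<n∨m≡n h1≤n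
... | inj₁ h1<n = rowmotion-topOnly l0 h0 l1 k1 h0≤l0 h0≤n l1≤k1 h1<n
rowmotion-topOnly-any l0 h0 zero k1 h0≤l0 h0≤n l1≤k1 h1≤n | inj₂ refl = rowmotion-topFull-from0 l0 h0 h0≤l0 h0≤n (s≤s z≤n)
rowmotion-topOnly-any l0 h0 (suc j) k1 h0≤l0 h0≤n l1≤k1 h1≤n | inj₂ refl = rowmotion-topFull l0 h0 j h0≤l0 h0≤n (s≤s l1≤k1)

rowmotion-bottomOnly-any : ∀ {n} l0 k0 l1 h1 → l0 ≤ k0 → suc k0 ≤ n → h1 ≤ l1 →
  RowmotionStep n ((l0 , suc k0) , (l1 , h1))
rowmotion-bottomOnly-any l0 k0 l1 h1 l0≤k0 h0≤n h1≤l1 with m≤n⇒m<n∨m≡n h0≤n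
... | inj₁ h0<n = rowmotion-bottomOnly l0 k0 l1 h1 l0≤k0 h0<n h1≤l1
... | inj₂ refl = rowmotion-bottomOnly-full l0 k0 l1 h1 l0≤k0 h1≤l1

rowmotion-sameEnd-any : ∀ {n} l0 k l1 → l0 ≤ k → l1 ≤ l0 → suc k ≤ n → RowmotionStep n ((l0 , suc k) , (l1 , suc k))
rowmotion-sameEnd-any l0 k l1 l0≤k l1≤l0 h0≤n with m≤n⇒m<n∨m≡n h0≤n
... | inj₁ h0<n = rowmotion-sameEnd l0 k l1 l0≤k l1≤l0 h0<n
rowmotion-sameEnd-any l0 k zero l0≤k l1≤l0 h0≤n | inj₂ refl = rowmotion-sameEnd-full-from0 l0 k l0≤k
rowmotion-sameEnd-any l0 k (suc j) l0≤k l1≤l0 h0≤n | inj₂ refl = rowmotion-sameEnd-full l0 k j l0≤k l1≤l0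

rowmotion-leftOverhang-any : ∀ {n} l0 k0 l1 k1 → l0 ≤ k0 → l1 ≤ k1 → l1 < l0 → k1 < k0 → suc k0 ≤ n →
  RowmotionStep n ((l0 , suc k0) , (l1 , suc k1))
rowmotion-leftOverhang-any l0 k0 l1 k1 l0≤k0 l1≤k1 l1<l0 k1<k0 h0≤n with m≤n⇒m<n∨m≡n h0≤n
... | inj₁ h0<n = rowmotion-leftOverhang l0 k0 l1 k1 l0≤k0 l1≤k1 l1<l0 k1<k0 h0<n
... | inj₂ refl with suc k1 <? l0
...   | yes h1<l0 = rowmotion-leftOverhang-full-disjoint l0 k0 l1 k1 l0≤k0 l1≤k1 l1<l0 k1<k0 h1<l0
...   | no h1≮l0 = rowmotion-leftOverhang-full-overlap l0 k0 l1 k1 l0≤k0 l1≤k1 l1<l0 k1<k0 (≮⇒≥ h1≮l0)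

rowmotion-sameStart-any : ∀ {n} l0 k0 k1 → l0 ≤ k1 → k1 < k0 → suc k0 ≤ n → RowmotionStep n ((l0 , suc k0) , (l0 , suc k1))
rowmotion-sameStart-any l0 k0 k1 l0≤k1 k1<k0 h0≤n with m≤n⇒m<n∨m≡n h0≤n
... | inj₁ h0<n = rowmotion-sameStart l0 k0 k1 l0≤k1 k1<k0 h0<n
... | inj₂ refl = rowmotion-sameStart-full l0 k0 k1 l0≤k1 k1<k0

rowmotion-bothNonempty : ∀ {n} l0 k0 l1 k1 → l0 ≤ k0 → l1 ≤ k1 → l1 ≤ l0 → k1 ≤ k0 → suc k0 ≤ n →
  RowmotionStep n ((l0 , suc k0) , (l1 , suc k1))
rowmotion-bothNonempty l0 k0 l1 k1 l0≤k0 l1≤k1 l1≤l0 k1≤k0 h0≤n with m≤n⇒m<n∨m≡n k1≤k0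
... | inj₂ refl = rowmotion-sameEnd-any l0 k1 l1 l0≤k0 l1≤l0 h0≤n
... | inj₁ k1<k0 with m≤n⇒m<n∨m≡n l1≤l0
...   | inj₁ l1<l0 = rowmotion-leftOverhang-any l0 k0 l1 k1 l0≤k0 l1≤k1 l1<l0 k1<k0 h0≤n
...   | inj₂ refl = rowmotion-sameStart-any l1 k0 k1 l1≤k1 k1<k0 h0≤n

rowmotion-shape : ∀ {n} → 1 ≤ n → ∀ σ → proj₂ (proj₁ σ) ≤ n → proj₂ (proj₂ σ) ≤ n → IsICShape σ → RowmotionStep n σ
rowmotion-shape {suc m} _ ((l0 , h0) , (l1 , h1)) h0≤n h1≤n ok with emptiness l0 h0 | emptiness l1 h1
... | empty h0≤l0 | empty h1≤l1 = rowmotion-empty m l0 h0 l1 h1 h0≤l0 h0≤n h1≤l1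
... | empty h0≤l0 | nonempty l1≤k1 = rowmotion-topOnly-any l0 h0 l1 _ h0≤l0 h0≤n l1≤k1 h1≤n
... | nonempty l0≤k0 | empty h1≤l1 = rowmotion-bottomOnly-any l0 _ l1 h1 l0≤k0 h0≤n h1≤l1
... | nonempty l0≤k0 | nonempty l1≤k1 with ok
...   | inj₁ h0≤l0 = ⊥-elim (<⇒≱ (s≤s l0≤k0) h0≤l0)
...   | inj₂ (inj₁ h1≤l1) = ⊥-elim (<⇒≱ (s≤s l1≤k1) h1≤l1)
...   | inj₂ (inj₂ (l1≤l0 , s≤s k1≤k0)) = rowmotion-bothNonempty l0 _ l1 _ l0≤k0 l1≤k1 l1≤l0 k1≤k0 h0≤n

-- Counting extremal elements

module Count {n : ℕ} {P : Elem n → Set} (P? : ∀ x → Dec (P x)) where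

  #row : Fin 2 → ℕ
  #row a = length (filter P? (map (a ,_) (allFin n)))

  #linExt : length (filter P? (linExt n)) ≡ #row r0 + #row r1
  #linExt = begin
    length (filter P? (row₀ ++ row₁ ++ []))            ≡⟨ cong length (filter-++ P? row₀ (row₁ ++ [])) ⟩
    length (filter P? row₀ ++ filter P? (row₁ ++ []))  ≡⟨ length-++ (filter P? row₀) ⟩
    #row r0 + length (filter P? (row₁ ++ []))          ≡⟨ cong (λ xs → #row r0 + length (filter P? xs)) (++-identityʳ row₁) ⟩
    #row r0 + #row r1                                  ∎
    where
    open ≡-Reasoning
    row₀ row₁ : List (Elem n)
    row₀ = map (r0 ,_) (allFin n)
    row₁ = map (r1 ,_) (allFin n)

  private
    #columns-none : ∀ (a : Fin 2) k u (f : Fin k → Fin n) → EnumeratesFrom u f →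
      (∀ c → u ≤ toℕ c → ¬ P (a , c)) → length (filter P? (map (a ,_) (tabulate f))) ≡ 0
    #columns-none a zero u f f≡ none = refl
    #columns-none a (suc k) u f f≡ none =
      trans (cong length (filter-reject P? (none (f fzero) (≤-reflexive (sym (enumeratesFrom-head f≡))))))
        (#columns-none a k (suc u) (f ∘ fsuc) (enumeratesFrom-tail f≡) (λ c p → none c (≤-trans (n≤1+n u) p)))

    #columns-one : ∀ (a : Fin 2) k u m (f : Fin k → Fin n) → EnumeratesFrom u f →
      (∀ c → P (a , c) → toℕ c ≡ m) → (∀ c → toℕ c ≡ m → P (a , c)) → u ≤ m → m < u + k →
      length (filter P? (map (a ,_) (tabulate f))) ≡ 1
    #columns-one a zero u m f f≡ only at u≤m m<u+0 = ⊥-elim (<⇒≱ m<u+0 (subst (_≤ m) (sym (+-identityʳ u)) u≤m))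
    #columns-one a (suc k) u m f f≡ only at u≤m m<u+k with u ≟ m
    ... | yes refl = trans (cong length (filter-accept P? (at (f fzero) (enumeratesFrom-head f≡))))
                       (cong suc (#columns-none a k (suc u) (f ∘ fsuc) (enumeratesFrom-tail f≡)
                         (λ c p q → <-irrefl (sym (only c q)) p)))
    ... | no u≢m = trans (cong length (filter-reject P? (λ p → u≢m (trans (sym (enumeratesFrom-head f≡)) (only (f fzero) p)))))
                     (#columns-one a k (suc u) m (f ∘ fsuc) (enumeratesFrom-tail f≡) only at
                       (≤∧≢⇒< u≤m u≢m) (subst (m <_) (+-suc u k) m<u+k))

  #row-none : ∀ (a : Fin 2) → (∀ c → ¬ P (a , c)) → #row a ≡ 0
  #row-none a none = #columns-none a n 0 (λ i → i) (λ i → refl) (λ c _ → none c)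

  #row-one : ∀ (a : Fin 2) m → m < n → (∀ c → P (a , c) → toℕ c ≡ m) → (∀ c → toℕ c ≡ m → P (a , c)) → #row a ≡ 1
  #row-one a m m<n only at = #columns-one a n 0 m (λ i → i) (λ i → refl) only at z≤n m<n

<P-column : ∀ {n} (a : Fin 2) (d c : Fin n) → toℕ d < toℕ c → (a , d) <P (a , c)
<P-column a d c d<c = (≤-refl , <⇒≤ d<c) , λ e → <⇒≢ d<c (cong (toℕ ∘ proj₂) e)

member-row : ∀ {n} σ a (c : Fin n) → (a , c) ∈ ⟦ σ ⟧ → proj₁ (row a σ) ≤ toℕ c × toℕ c < proj₂ (row a σ)
member-row σ a c c∈ = inInterval-bounds c∈

¬member-emptyRow : ∀ {n} σ a (c : Fin n) → proj₂ (row a σ) ≤ proj₁ (row a σ) → ¬ (a , c) ∈ ⟦ σ ⟧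
¬member-emptyRow σ a c h≤l c∈ = let (l≤c , c<h) = member-row σ a c c∈ in <⇒≱ (≤-<-trans l≤c c<h) h≤l

max-at-end : ∀ {n} σ a (c : Fin n) → proj₂ (row a σ) ≤ n → IsMax ⟦ σ ⟧ (a , c) → suc (toℕ c) ≡ proj₂ (row a σ)
max-at-end {n} σ a c h≤n (c∈ , maximal) with suc (toℕ c) ≟ proj₂ (row a σ)
... | yes c+1≡h = c+1≡h
... | no c+1≢h = ⊥-elim (maximal (cell a p) next∈ (<P-column a c (fromℕ< p) (subst (toℕ c <_) (sym (toℕ-fromℕ< p)) (n<1+n _))))
  where
  bounds = member-row σ a c c∈
  c+1<h : suc (toℕ c) < proj₂ (row a σ)
  c+1<h = ≤∧≢⇒< (proj₂ bounds) c+1≢h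
  p : suc (toℕ c) < n
  p = <-≤-trans c+1<h h≤n
  next∈ : cell a p ∈ ⟦ σ ⟧
  next∈ = trans (⟦⟧-cell σ a p) (inInterval-true (≤-trans (proj₁ bounds) (n≤1+n _)) c+1<h)

min-at-start : ∀ {n} σ a (c : Fin n) → IsMin ⟦ σ ⟧ (a , c) → toℕ c ≡ proj₁ (row a σ)
min-at-start {n} σ a c (c∈ , minimal) with toℕ c ≟ proj₁ (row a σ)
... | yes c≡l = c≡l
... | no c≢l = ⊥-elim (minimal (cell a p) prev∈ (<P-column a (fromℕ< p) c (subst (_< toℕ c) (sym (toℕ-fromℕ< p)) j<c)))
  where
  bounds = member-row σ a c c∈
  l<c : proj₁ (row a σ) < toℕ c
  l<c = ≤∧≢⇒< (proj₁ bounds) (λ e → c≢l (sym e))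
  j = proj₁ (pred-of l<c)
  c≡1+j = proj₂ (pred-of l<c)
  j<c : j < toℕ c
  j<c = subst (j <_) (sym c≡1+j) (n<1+n j)
  p : j < n
  p = <-trans j<c (toℕ<n c)
  prev∈ : cell a p ∈ ⟦ σ ⟧
  prev∈ = trans (⟦⟧-cell σ a p) (inInterval-true (≤-pred (subst (proj₁ (row a σ) <_) c≡1+j l<c)) (<-trans j<c (proj₂ bounds)))

module ShapeStat (n l0 h0 l1 h1 : ℕ) (h0≤n : h0 ≤ n) (h1≤n : h1 ≤ n) (ok : IsICShape ((l0 , h0) , (l1 , h1))) where

  σ : Shape
  σ = (l0 , h0) , (l1 , h1)

  S : Subset n
  S = ⟦ σ ⟧

  nested : l0 < h0 → l1 < h1 → (l1 ≤ l0) × (h1 ≤ h0)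
  nested l0<h0 l1<h1 = from ok
    where
    from : IsICShape σ → (l1 ≤ l0) × (h1 ≤ h0)
    from (inj₁ h0≤l0) = ⊥-elim (<⇒≱ l0<h0 h0≤l0)
    from (inj₂ (inj₁ h1≤l1)) = ⊥-elim (<⇒≱ l1<h1 h1≤l1)
    from (inj₂ (inj₂ l1≤l0×h1≤h0)) = l1≤l0×h1≤h0

  max₀ : l0 < h0 → ¬ (l1 < h1 × h1 ≡ h0) → ∀ c → suc (toℕ c) ≡ h0 → IsMax S (r0 , c)
  max₀ l0<h0 ¬sameEnd c c+1≡h0 = inInterval-true (≤-pred (subst (l0 <_) (sym c+1≡h0) l0<h0)) (subst (toℕ c <_) c+1≡h0 ≤-refl) , maximal
    where
    maximal : ∀ y → y ∈ S → ¬ ((r0 , c) <P y)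
    maximal (fzero , d) d∈ ((_ , c≤d) , c≢d) =
      c≢d (cong (r0 ,_) (toℕ-injective (≤-antisym c≤d (≤-pred (subst (toℕ d <_) (sym c+1≡h0) (proj₂ (member-row σ r0 d d∈)))))))
    maximal (fsuc fzero , d) d∈ ((_ , c≤d) , _) =
      let (l1≤d , d<h1) = member-row σ r1 d d∈
          (_ , h1≤h0) = nested l0<h0 (≤-<-trans l1≤d d<h1)
          d≡c : toℕ d ≡ toℕ c
          d≡c = ≤-antisym (≤-pred (≤-trans d<h1 (subst (h1 ≤_) (sym c+1≡h0) h1≤h0))) c≤d
      in ¬sameEnd (≤-<-trans l1≤d d<h1 , ≤-antisym h1≤h0 (subst (_≤ h1) (trans (cong suc d≡c) c+1≡h0) d<h1))

  ¬max₀ : l1 < h1 → h1 ≡ h0 → ∀ c → ¬ IsMax S (r0 , c)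
  ¬max₀ l1<h1 h1≡h0 c (c∈ , maximal) =
    let (l0≤c , c<h0) = member-row σ r0 c c∈
        (l1≤l0 , _) = nested (≤-<-trans l0≤c c<h0) l1<h1
    in maximal (r1 , c) (inInterval-true (≤-trans l1≤l0 l0≤c) (subst (toℕ c <_) (sym h1≡h0) c<h0)) ((z≤n , ≤-refl) , λ ())

  max₁ : l1 < h1 → ∀ c → suc (toℕ c) ≡ h1 → IsMax S (r1 , c)
  max₁ l1<h1 c c+1≡h1 = inInterval-true (≤-pred (subst (l1 <_) (sym c+1≡h1) l1<h1)) (subst (toℕ c <_) c+1≡h1 ≤-refl) , maximal
    where
    maximal : ∀ y → y ∈ S → ¬ ((r1 , c) <P y)
    maximal (fzero , d) d∈ ((() , _) , _)
    maximal (fsuc fzero , d) d∈ ((_ , c≤d) , c≢d) =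
      c≢d (cong (r1 ,_) (toℕ-injective (≤-antisym c≤d (≤-pred (subst (toℕ d <_) (sym c+1≡h1) (proj₂ (member-row σ r1 d d∈)))))))

  min₀ : l0 < h0 → ∀ c → toℕ c ≡ l0 → IsMin S (r0 , c)
  min₀ l0<h0 c c≡l0 = inInterval-true (≤-reflexive (sym c≡l0)) (subst (_< h0) (sym c≡l0) l0<h0) , minimal
    where
    minimal : ∀ y → y ∈ S → ¬ (y <P (r0 , c))
    minimal (fzero , d) d∈ ((_ , d≤c) , d≢c) =
      d≢c (cong (r0 ,_) (toℕ-injective (≤-antisym d≤c (subst (_≤ toℕ d) (sym c≡l0) (proj₁ (member-row σ r0 d d∈))))))
    minimal (fsuc fzero , d) d∈ ((() , _) , _)

  min₁ : l1 < h1 → ¬ (l0 < h0 × l1 ≡ l0) → ∀ c → toℕ c ≡ l1 → IsMin S (r1 , c)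
  min₁ l1<h1 ¬sameStart c c≡l1 = inInterval-true (≤-reflexive (sym c≡l1)) (subst (_< h1) (sym c≡l1) l1<h1) , minimal
    where
    minimal : ∀ y → y ∈ S → ¬ (y <P (r1 , c))
    minimal (fsuc fzero , d) d∈ ((_ , d≤c) , d≢c) =
      d≢c (cong (r1 ,_) (toℕ-injective (≤-antisym d≤c (subst (_≤ toℕ d) (sym c≡l1) (proj₁ (member-row σ r1 d d∈))))))
    minimal (fzero , d) d∈ ((_ , d≤c) , _) =
      let (l0≤d , d<h0) = member-row σ r0 d d∈
          (l1≤l0 , _) = nested (≤-<-trans l0≤d d<h0) l1<h1
      in ¬sameStart (≤-<-trans l0≤d d<h0 , ≤-antisym l1≤l0 (≤-trans l0≤d (subst (toℕ d ≤_) c≡l1 d≤c)))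

  ¬min₁ : l0 < h0 → l1 ≡ l0 → ∀ c → ¬ IsMin S (r1 , c)
  ¬min₁ l0<h0 l1≡l0 c c-min@(_ , minimal) =
    let c≡l0 = trans (min-at-start σ r1 c c-min) l1≡l0
    in minimal (r0 , c) (inInterval-true (≤-reflexive (sym c≡l0)) (subst (_< h0) (sym c≡l0) l0<h0)) ((z≤n , ≤-refl) , λ ())

  module Max = Count (isMax? S)
  module Min = Count (isMin? S)

  #max₀-empty : h0 ≤ l0 → Max.#row r0 ≡ 0
  #max₀-empty h0≤l0 = Max.#row-none r0 (λ c (c∈ , _) → ¬member-emptyRow σ r0 c h0≤l0 c∈)

  #max₀-covered : l1 < h1 → h1 ≡ h0 → Max.#row r0 ≡ 0
  #max₀-covered l1<h1 h1≡h0 = Max.#row-none r0 (¬max₀ l1<h1 h1≡h0)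

  #max₀-one : l0 < h0 → ¬ (l1 < h1 × h1 ≡ h0) → Max.#row r0 ≡ 1
  #max₀-one l0<h0 ¬sameEnd = Max.#row-one r0 k (<-≤-trans (subst (k <_) (sym h0≡1+k) ≤-refl) h0≤n)
    (λ c c-max → suc-injective (trans (max-at-end σ r0 c h0≤n c-max) h0≡1+k))
    (λ c c≡k → max₀ l0<h0 ¬sameEnd c (trans (cong suc c≡k) (sym h0≡1+k)))
    where
    k = proj₁ (pred-of l0<h0)
    h0≡1+k = proj₂ (pred-of l0<h0)

  #max₁-empty : h1 ≤ l1 → Max.#row r1 ≡ 0
  #max₁-empty h1≤l1 = Max.#row-none r1 (λ c (c∈ , _) → ¬member-emptyRow σ r1 c h1≤l1 c∈)

  #max₁-one : l1 < h1 → Max.#row r1 ≡ 1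
  #max₁-one l1<h1 = Max.#row-one r1 k (<-≤-trans (subst (k <_) (sym h1≡1+k) ≤-refl) h1≤n)
    (λ c c-max → suc-injective (trans (max-at-end σ r1 c h1≤n c-max) h1≡1+k))
    (λ c c≡k → max₁ l1<h1 c (trans (cong suc c≡k) (sym h1≡1+k)))
    where
    k = proj₁ (pred-of l1<h1)
    h1≡1+k = proj₂ (pred-of l1<h1)

  #min₀-empty : h0 ≤ l0 → Min.#row r0 ≡ 0
  #min₀-empty h0≤l0 = Min.#row-none r0 (λ c (c∈ , _) → ¬member-emptyRow σ r0 c h0≤l0 c∈)

  #min₀-one : l0 < h0 → Min.#row r0 ≡ 1
  #min₀-one l0<h0 = Min.#row-one r0 l0 (<-≤-trans l0<h0 h0≤n) (min-at-start σ r0) (min₀ l0<h0)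

  #min₁-empty : h1 ≤ l1 → Min.#row r1 ≡ 0
  #min₁-empty h1≤l1 = Min.#row-none r1 (λ c (c∈ , _) → ¬member-emptyRow σ r1 c h1≤l1 c∈)

  #min₁-covered : l0 < h0 → l1 ≡ l0 → Min.#row r1 ≡ 0
  #min₁-covered l0<h0 l1≡l0 = Min.#row-none r1 (¬min₁ l0<h0 l1≡l0)

  #min₁-one : l1 < h1 → ¬ (l0 < h0 × l1 ≡ l0) → Min.#row r1 ≡ 1
  #min₁-one l1<h1 ¬sameStart = Min.#row-one r1 l1 (<-≤-trans l1<h1 h1≤n) (min-at-start σ r1) (min₁ l1<h1 ¬sameStart)

  private
    stat-from-counts : ∀ {a₀ a₁ b₀ b₁ c d} → Max.#row r0 ≡ a₀ → Max.#row r1 ≡ a₁ → Min.#row r0 ≡ b₀ → Min.#row r1 ≡ b₁ →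
      #rightOverhang S ≡ c → #leftOverhang S ≡ d → (+ (a₀ + a₁)) - (+ (b₀ + b₁)) ≡ (+ c) - (+ d) →
      stat S ≡ (+ #rightOverhang S) - (+ #leftOverhang S)
    stat-from-counts a₀≡ a₁≡ b₀≡ b₁≡ c≡ d≡ counts =
      trans (cong₂ (λ a b → (+ a) - (+ b)) (trans Max.#linExt (cong₂ _+_ a₀≡ a₁≡)) (trans Min.#linExt (cong₂ _+_ b₀≡ b₁≡)))
        (trans counts (sym (cong₂ (λ a b → (+ a) - (+ b)) c≡ d≡)))

  stat-shape : stat S ≡ (+ #rightOverhang S) - (+ #leftOverhang S)
  stat-shape with h0 ≤? l0 | h1 ≤? l1
  ... | yes h0≤l0 | yes h1≤l1 =
    stat-from-counts (#max₀-empty h0≤l0) (#max₁-empty h1≤l1) (#min₀-empty h0≤l0) (#min₁-empty h1≤l1)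
      (#rightOverhang-shape-no σ (λ (c , _) → <⇒≱ c h0≤l0)) (#leftOverhang-shape-no σ (λ (c , _) → <⇒≱ c h0≤l0)) refl
  ... | yes h0≤l0 | no h1≰l1 =
    stat-from-counts (#max₀-empty h0≤l0) (#max₁-one (≰⇒> h1≰l1)) (#min₀-empty h0≤l0)
      (#min₁-one (≰⇒> h1≰l1) (λ (c , _) → <⇒≱ c h0≤l0))
      (#rightOverhang-shape-no σ (λ (c , _) → <⇒≱ c h0≤l0)) (#leftOverhang-shape-no σ (λ (c , _) → <⇒≱ c h0≤l0)) refl
  ... | no h0≰l0 | yes h1≤l1 =
    stat-from-counts (#max₀-one (≰⇒> h0≰l0) (λ (c , _) → <⇒≱ c h1≤l1)) (#max₁-empty h1≤l1)
      (#min₀-one (≰⇒> h0≰l0)) (#min₁-empty h1≤l1)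
      (#rightOverhang-shape-no σ (λ (_ , c , _) → <⇒≱ c h1≤l1)) (#leftOverhang-shape-no σ (λ (_ , c , _) → <⇒≱ c h1≤l1)) refl
  ... | no h0≰l0 | no h1≰l1 with nested (≰⇒> h0≰l0) (≰⇒> h1≰l1) | l0 <? h1
  ...   | _ | no l0≮h1 =
    stat-from-counts (#max₀-one l0<h0 (λ (_ , e) → l0≮h1 (subst (l0 <_) (sym e) l0<h0))) (#max₁-one l1<h1) (#min₀-one l0<h0)
      (#min₁-one l1<h1 (λ (_ , e) → l0≮h1 (subst (_< h1) e l1<h1)))
      (#rightOverhang-shape-no σ (λ (_ , _ , c , _) → l0≮h1 c)) (#leftOverhang-shape-no σ (λ (_ , _ , c , _) → l0≮h1 c)) refl
    where
    l0<h0 = ≰⇒> h0≰l0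
    l1<h1 = ≰⇒> h1≰l1
  ...   | (l1≤l0 , h1≤h0) | yes l0<h1 with m≤n⇒m<n∨m≡n h1≤h0 | m≤n⇒m<n∨m≡n l1≤l0
  ...     | inj₁ h1<h0 | inj₁ l1<l0 =
    stat-from-counts (#max₀-one l0<h0 (λ (_ , e) → <-irrefl e h1<h0)) (#max₁-one l1<h1) (#min₀-one l0<h0)
      (#min₁-one l1<h1 (λ (_ , e) → <-irrefl e l1<l0))
      (#rightOverhang-shape-yes σ h0≤n ok (l0<h0 , l1<h1 , l0<h1 , h1<h0)) (#leftOverhang-shape-yes σ h0≤n (l0<h0 , l1<h1 , l0<h1 , l1<l0)) refl
    where
    l0<h0 = ≰⇒> h0≰l0
    l1<h1 = ≰⇒> h1≰l1
  ...     | inj₁ h1<h0 | inj₂ l1≡l0 =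
    stat-from-counts (#max₀-one l0<h0 (λ (_ , e) → <-irrefl e h1<h0)) (#max₁-one l1<h1) (#min₀-one l0<h0) (#min₁-covered l0<h0 l1≡l0)
      (#rightOverhang-shape-yes σ h0≤n ok (l0<h0 , l1<h1 , l0<h1 , h1<h0)) (#leftOverhang-shape-no σ (λ (_ , _ , _ , c) → <-irrefl l1≡l0 c)) refl
    where
    l0<h0 = ≰⇒> h0≰l0
    l1<h1 = ≰⇒> h1≰l1
  ...     | inj₂ h1≡h0 | inj₁ l1<l0 =
    stat-from-counts (#max₀-covered l1<h1 h1≡h0) (#max₁-one l1<h1) (#min₀-one l0<h0) (#min₁-one l1<h1 (λ (_ , e) → <-irrefl e l1<l0))
      (#rightOverhang-shape-no σ (λ (_ , _ , _ , c) → <-irrefl h1≡h0 c)) (#leftOverhang-shape-yes σ h0≤n (l0<h0 , l1<h1 , l0<h1 , l1<l0)) refl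
    where
    l0<h0 = ≰⇒> h0≰l0
    l1<h1 = ≰⇒> h1≰l1
  ...     | inj₂ h1≡h0 | inj₂ l1≡l0 =
    stat-from-counts (#max₀-covered l1<h1 h1≡h0) (#max₁-one l1<h1) (#min₀-one l0<h0) (#min₁-covered l0<h0 l1≡l0)
      (#rightOverhang-shape-no σ (λ (_ , _ , _ , c) → <-irrefl h1≡h0 c)) (#leftOverhang-shape-no σ (λ (_ , _ , _ , c) → <-irrefl l1≡l0 c)) refl
    where
    l0<h0 = ≰⇒> h0≰l0
    l1<h1 = ≰⇒> h1≰l1

-- Interval-closed sets are shapes

RowConvex : ∀ {n} → (Fin n → Bool) → Set
RowConvex {n} f = ∀ (b c d : Fin n) → toℕ b ≤ toℕ c → toℕ c ≤ toℕ d → f b ≡ true → f d ≡ true → f c ≡ true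

inInterval-suc : ∀ {l h c} → inInterval (suc l , suc h) (suc c) ≡ inInterval (l , h) c
inInterval-suc {l} {h} {c} = ≡true-iff⇒≡ (inInterval (l , h) c) (inInterval (suc l , suc h) (suc c))
  (λ e → let (l≤c , c<h) = inInterval-bounds {l} {h} e in inInterval-true (s≤s l≤c) (s≤s c<h))
  (λ e → let (l≤c , c<h) = inInterval-bounds {suc l} {suc h} e in inInterval-true (≤-pred l≤c) (≤-pred c<h))

inInterval-0-suc : ∀ {h c} → inInterval (0 , suc h) (suc c) ≡ inInterval (0 , h) c
inInterval-0-suc {h} {c} = ≡true-iff⇒≡ (inInterval (0 , h) c) (inInterval (0 , suc h) (suc c))
  (λ e → inInterval-true z≤n (s≤s (proj₂ (inInterval-bounds {0} {h} e))))
  (λ e → inInterval-true z≤n (≤-pred (proj₂ (inInterval-bounds {0} {suc h} e))))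

convex⇒interval : ∀ n (f : Fin n → Bool) → RowConvex f →
  Σ ℕ λ l → Σ ℕ λ h → (h ≤ n) × (∀ c → f c ≡ inInterval (l , h) (toℕ c))
convex⇒interval zero f convex = 0 , 0 , z≤n , λ ()
convex⇒interval (suc n) f convex
  with convex⇒interval n (f ∘ fsuc) (λ b c d p q → convex (fsuc b) (fsuc c) (fsuc d) (s≤s p) (s≤s q))
... | l , h , h≤n , f≡ with f fzero in f0≡
...   | false = suc l , suc h , s≤s h≤n , f≡′
  where
  f≡′ : ∀ c → f c ≡ inInterval (suc l , suc h) (toℕ c)
  f≡′ fzero = trans f0≡ (sym (inInterval-below {suc l} {suc h} {0} (s≤s z≤n)))
  f≡′ (fsuc c) = trans (f≡ c) (sym inInterval-suc)
...   | true with h ≤? l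
...     | yes h≤l = 0 , 1 , s≤s z≤n , f≡′
  where
  f≡′ : ∀ c → f c ≡ inInterval (0 , 1) (toℕ c)
  f≡′ fzero = trans f0≡ (sym (inInterval-true z≤n (s≤s z≤n)))
  f≡′ (fsuc c) = trans (f≡ c) (trans (inInterval-empty {l} {h} {toℕ c} h≤l) (sym (inInterval-above {0} {1} {suc (toℕ c)} (s≤s z≤n))))
convex⇒interval (suc n) f convex | zero , h , h≤n , f≡ | true | no _ = 0 , suc h , s≤s h≤n , f≡′
  where
  f≡′ : ∀ c → f c ≡ inInterval (0 , suc h) (toℕ c)
  f≡′ fzero = trans f0≡ (sym (inInterval-true z≤n (s≤s z≤n)))
  f≡′ (fsuc c) = trans (f≡ c) (sym inInterval-0-suc)
-- f is true at column 0 and from column l+1 on, but false at column 1: a hole.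
convex⇒interval (suc n) f convex | suc l′ , h , h≤n , f≡ | true | no h≰l =
  ⊥-elim (true≢false (trans (sym at-1)
    (trans (f≡ c0) (trans (cong (inInterval (suc l′ , h)) (toℕ-fromℕ< p₀)) (inInterval-below {suc l′} {h} {0} (s≤s z≤n))))))
  where
  l<h : suc l′ < h
  l<h = ≰⇒> h≰l
  pₗ : suc l′ < n
  pₗ = <-≤-trans l<h h≤n
  p₀ : 0 < n
  p₀ = ≤-<-trans z≤n pₗ
  c0 d : Fin n
  c0 = fromℕ< p₀
  d = fromℕ< pₗ
  at-d : f (fsuc d) ≡ true
  at-d = trans (f≡ d) (trans (cong (inInterval (suc l′ , h)) (toℕ-fromℕ< pₗ)) (inInterval-true ≤-refl l<h))
  at-1 : f (fsuc c0) ≡ true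
  at-1 = convex fzero (fsuc c0) (fsuc d) z≤n (s≤s (subst₂ _≤_ (sym (toℕ-fromℕ< p₀)) (sym (toℕ-fromℕ< pₗ)) z≤n)) f0≡ at-d

intervalClosed⇒IsICShape : ∀ {n} l0 h0 l1 h1 → h0 ≤ n → h1 ≤ n → IsIntervalClosed {n} ⟦ (l0 , h0) , (l1 , h1) ⟧ →
  IsICShape ((l0 , h0) , (l1 , h1))
intervalClosed⇒IsICShape l0 h0 l1 h1 h0≤n h1≤n ic with h0 ≤? l0 | h1 ≤? l1
... | yes h0≤l0 | _ = inj₁ h0≤l0
... | no _ | yes h1≤l1 = inj₂ (inj₁ h1≤l1)
... | no h0≰l0 | no h1≰l1 = inj₂ (inj₂ (≮⇒≥ (¬misplaced ∘ inj₁) , ≮⇒≥ (¬misplaced ∘ inj₂)))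
  where
  l0<h0 = ≰⇒> h0≰l0
  l1<h1 = ≰⇒> h1≰l1
  ¬misplaced : ¬ (l0 < l1 ⊎ h0 < h1)
  ¬misplaced w with l0 <? h1 | w
  ... | yes l0<h1 | _ = shape-¬intervalClosed l0 h0 l1 h1 h0≤n h1≤n l0<h0 l1<h1 l0<h1 w ic
  ... | no l0≮h1 | inj₁ l0<l1 = <⇒≱ l0<l1 (<⇒≤ (<-≤-trans l1<h1 (≮⇒≥ l0≮h1)))
  ... | no l0≮h1 | inj₂ h0<h1 = <⇒≱ h0<h1 (≤-trans (≮⇒≥ l0≮h1) (<⇒≤ l0<h0))

-- Telescoping along an orbit

record ShapeOf {n : ℕ} (X : Subset n) : Set where
  field
    shape : Shape
    bounded₀ : proj₂ (proj₁ shape) ≤ n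
    bounded₁ : proj₂ (proj₂ shape) ≤ n
    isICShape : IsICShape shape
    ≐shape : X ≐ ⟦ shape ⟧

intervalClosed⇒shapeOf : ∀ {n} (I : Subset n) → IsIntervalClosed I → ShapeOf I
intervalClosed⇒shapeOf {n} I ic
  with convex⇒interval n (λ c → I (r0 , c)) (convex r0) | convex⇒interval n (λ c → I (r1 , c)) (convex r1)
  where
  convex : ∀ a → RowConvex (λ c → I (a , c))
  convex a b c d b≤c c≤d b∈ d∈ = ic (a , b) (a , d) (a , c) b∈ d∈ (≤-refl , b≤c) (≤-refl , c≤d)
... | l0 , h0 , h0≤n , I≡₀ | l1 , h1 , h1≤n , I≡₁ = record
  { shape = σ
  ; bounded₀ = h0≤n
  ; bounded₁ = h1≤n
  ; isICShape = intervalClosed⇒IsICShape l0 h0 l1 h1 h0≤n h1≤n (intervalClosed-resp-≐ I≐σ ic)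
  ; ≐shape = I≐σ
  }
  where
  σ = (l0 , h0) , (l1 , h1)
  I≐σ : I ≐ ⟦ σ ⟧
  I≐σ (fzero , c) = I≡₀ c
  I≐σ (fsuc fzero , c) = I≡₁ c

rowmotion-cong : ∀ {n} {I J : Subset n} → I ≐ J → rowmotion I ≐ rowmotion J
rowmotion-cong {n} {I} {J} e =
  ≐-trans (≡⇒≐ (rowmotion≡sweeps I))
    (≐-trans (sweep-cong r0 (allFin n) (sweep-cong r1 (allFin n) e)) (≡⇒≐ (sym (rowmotion≡sweeps J))))

rowmotion-intervalClosed : ∀ {n} (I : Subset n) → IsIntervalClosed I → IsIntervalClosed (rowmotion I)
rowmotion-intervalClosed {n} I ic = subst IsIntervalClosed (sym (rowmotion≡sweeps I))
  (sweep-intervalClosed r0 (allFin n) _ (sweep-intervalClosed r1 (allFin n) I ic))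

module _ {n : ℕ} (ε : 1 ≤ n) {X : Subset n} (X-shape : ShapeOf X) where
  open ShapeOf X-shape
  open RowmotionStep (rowmotion-shape ε shape bounded₀ bounded₁ isICShape)

  rowmotion≐next : rowmotion X ≐ ⟦ next ⟧
  rowmotion≐next = ≐-trans (rowmotion-cong ≐shape) (≐-trans (≡⇒≐ (rowmotion≡sweeps ⟦ shape ⟧)) sweeps≐next)

  shapeOf-rowmotion : ShapeOf (rowmotion X)
  shapeOf-rowmotion = record
    { shape = next
    ; bounded₀ = next-bounded₀
    ; bounded₁ = next-bounded₁
    ; isICShape = intervalClosed⇒IsICShape _ _ _ _ next-bounded₀ next-bounded₁
        (intervalClosed-resp-≐ rowmotion≐next
          (rowmotion-intervalClosed X (intervalClosed-resp-≐ (≐-sym ≐shape) (shape-intervalClosed shape isICShape))))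
    ; ≐shape = rowmotion≐next
    }

  #leftOverhang-rowmotion : #leftOverhang (rowmotion X) ≡ #rightOverhang X
  #leftOverhang-rowmotion =
    trans (#leftOverhang-cong rowmotion≐next) (trans #left-next≡#right (sym (#rightOverhang-cong ≐shape)))

length-filter-⇔ : ∀ {A : Set} {P Q : A → Set} (P? : ∀ x → Dec (P x)) (Q? : ∀ x → Dec (Q x)) →
  (∀ x → P x → Q x) → (∀ x → Q x → P x) → ∀ xs → length (filter P? xs) ≡ length (filter Q? xs)
length-filter-⇔ P? Q? f g [] = refl
length-filter-⇔ {P = P} P? Q? f g (x ∷ xs) = by (P? x)
  where
  by : Dec (P x) → length (filter P? (x ∷ xs)) ≡ length (filter Q? (x ∷ xs))
  by (yes p) = trans (cong length (filter-accept P? p))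
    (trans (cong suc (length-filter-⇔ P? Q? f g xs)) (sym (cong length (filter-accept Q? (f x p)))))
  by (no ¬p) = trans (cong length (filter-reject P? ¬p))
    (trans (length-filter-⇔ P? Q? f g xs) (sym (cong length (filter-reject Q? (λ q → ¬p (g x q))))))

isMax-resp-≐ : ∀ {n} {I J : Subset n} → I ≐ J → ∀ x → IsMax I x → IsMax J x
isMax-resp-≐ e x (x∈ , maximal) = trans (sym (e x)) x∈ , λ y y∈ → maximal y (trans (e y) y∈)

isMin-resp-≐ : ∀ {n} {I J : Subset n} → I ≐ J → ∀ x → IsMin I x → IsMin J x
isMin-resp-≐ e x (x∈ , minimal) = trans (sym (e x)) x∈ , λ y y∈ → minimal y (trans (e y) y∈)

stat-cong : ∀ {n} {I J : Subset n} → I ≐ J → stat I ≡ stat J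
stat-cong {n} {I} {J} e = cong₂ (λ a b → (+ a) - (+ b))
  (length-filter-⇔ (isMax? I) (isMax? J) (isMax-resp-≐ e) (isMax-resp-≐ (≐-sym e)) (linExt n))
  (length-filter-⇔ (isMin? I) (isMin? J) (isMin-resp-≐ e) (isMin-resp-≐ (≐-sym e)) (linExt n))

stat≡right-left : ∀ {n} {X : Subset n} → ShapeOf X → stat X ≡ (+ #rightOverhang X) - (+ #leftOverhang X)
stat≡right-left {n} {X} record { shape = (l0 , h0) , (l1 , h1) ; bounded₀ = h0≤n ; bounded₁ = h1≤n ; isICShape = ok ; ≐shape = X≐ } =
  trans (stat-cong X≐)
    (trans (ShapeStat.stat-shape n l0 h0 l1 h1 h0≤n h1≤n ok)
      (sym (cong₂ (λ a b → (+ a) - (+ b)) (#rightOverhang-cong X≐) (#leftOverhang-cong X≐))))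

shapeOf-iterate : ∀ {n} → 1 ≤ n → (I : Subset n) → IsIntervalClosed I → ∀ i → ShapeOf (iterate rowmotion i I)
shapeOf-iterate ε I ic zero = intervalClosed⇒shapeOf I ic
shapeOf-iterate ε I ic (suc i) = shapeOf-rowmotion ε (shapeOf-iterate ε I ic i)

sumℤ-cong : ∀ k {f g : ℕ → ℤ} → (∀ i → f i ≡ g i) → sumℤ k f ≡ sumℤ k g
sumℤ-cong zero f≡g = refl
sumℤ-cong (suc k) f≡g = cong₂ _+ℤ_ (sumℤ-cong k f≡g) (f≡g k)

sumℤ-telescope : ∀ (a : ℕ → ℕ) k → sumℤ k (λ i → (+ a (suc i)) - (+ a i)) ≡ (+ a k) - (+ a 0)
sumℤ-telescope a zero = sym (+-inverseʳ (+ a 0))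
sumℤ-telescope a (suc k) = trans (cong (_+ℤ ((+ a (suc k)) - (+ a k))) (sumℤ-telescope a k)) (cancel (+ a k) (+ a 0) (+ a (suc k)))
  where
  cancel : ∀ (x y z : ℤ) → (x - y) +ℤ (z - x) ≡ z - y
  cancel = solve-∀

theorem4p7 : (n : ℕ) → 1 ≤ n →
    (I : Subset n) → IsIntervalClosed I →
    (k : ℕ) → 1 ≤ k → iterate rowmotion k I ≐ I →
    (∀ j → 1 ≤ j → j < k → ¬ (iterate rowmotion j I ≐ I)) →
    sumℤ k (λ i → stat (iterate rowmotion i I)) ≡ + 0
theorem4p7 n ε I ic k _ periodic _ = begin
  sumℤ k (λ i → stat (Rⁱ i))                  ≡⟨ sumℤ-cong k stat≡Δ ⟩
  sumℤ k (λ i → (+ left (suc i)) - (+ left i)) ≡⟨ sumℤ-telescope left k ⟩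
  (+ left k) - (+ left 0)                      ≡⟨ i≡j⇒i-j≡0 (cong +_ (#leftOverhang-cong periodic)) ⟩
  + 0                                          ∎
  where
  open ≡-Reasoning
  Rⁱ : ℕ → Subset n
  Rⁱ i = iterate rowmotion i I
  left : ℕ → ℕ
  left i = #leftOverhang (Rⁱ i)
  stat≡Δ : ∀ i → stat (Rⁱ i) ≡ (+ left (suc i)) - (+ left i)
  stat≡Δ i = trans (stat≡right-left (shapeOf-iterate ε I ic i))
    (cong (λ z → (+ z) - (+ left i)) (sym (#leftOverhang-rowmotion ε (shapeOf-iterate ε I ic i))))
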